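{- Let $E$ be a finite set, let $V$ be a linear subspace of $\mathrm{GF}(2)^E$, let $M:=M(V)$ with rank function $r$, and let $\iota$ denote the imaginary unit. If $q_V(x)=0$ for all $x\in V\cap V^\perp$, then $$T_M(-\iota,\iota)= e^{\frac{\pi \iota}{4}(\sigma(\tilde{q}_V)+|E|-3r(E))}\sqrt{2}^{\,d(V)},$$ and otherwise $T_M(-\iota,\iota)=0$.
   Context: For $v\in\mathrm{GF}(2)^E$, $\mathrm{supp}(v)=\{e\in E: v_e\neq 0\}$. For a subspace $V\subseteq \mathrm{GF}(2)^E$, $M(V)$ is the matroid on $E$ whose independent sets are the sets $F\subseteq E$ such that there is no nonzero $v\in V$ with $\mathrm{supp}(v)\subseteq F$ (so $r(E)=|E|-\dim V$). The Tutte polynomial of a matroid $M$ on $E$ with rank function $r$ is $T_M(x,y)=\sum_{F\subseteq E}(x-1)^{r(E)-r(F)}(y-1)^{|F|-r(F)}$. Let $b(x,y)=\sum_{e\in E}x_ey_e\in\mathrm{GF}(2)$, $V^\perp=\{w: b(w,v)=0\ \forall v\in V\}$, and the bicycle dimension $d(V):=\dim(V\cap V^\perp)$. Define $q_V:V\to\mathbb{Z}/4\mathbb{Z}$ by $q_V(x)=|\mathrm{supp}(x)| \bmod 4$. If $q_V$ vanishes on $V\cap V^\perp$, then $q_V(x+y)=q_V(x)$ for $x\in V$, $y\in V\cap V^\perp$, and $\tilde q_V: V/(V\cap V^\perp)\to\mathbb{Z}/4\mathbb{Z}$ is defined by $\tilde q_V(x+V\cap V^\perp)=q_V(x)$; it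 satisfies $\tilde q(x+y)=\tilde q(x)+\tilde q(y)+\alpha(\tilde b(x,y))$ with $\tilde b$ the nondegenerate bilinear form induced by $b$ and $\alpha:\mathrm{GF}(2)\to\mathbb{Z}/4\mathbb{Z}$, $\alpha(0)=0,\alpha(1)=2$. For such a nonsingular $\mathbb{Z}/4\mathbb{Z}$-valued quadratic form $q$ on a $\mathrm{GF}(2)$-space $W$, Brown's invariant $\sigma(q)\in\mathbb{Z}/8\mathbb{Z}$ is defined by $\sum_{x\in W}\iota^{q(x)}=\sqrt{2}^{\dim W}e^{\pi\iota\sigma(q)/4}$. -}

module Defs where

open import Data.Bool using (Bool; true; false; _∧_; _∨_; not; _xor_; if_then_else_)
open import Data.Nat using (ℕ; zero; suc; _∸_; _⊔_)
import Data.Nat as ℕ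
open import Data.Nat.Logarithm using (⌊log₂_⌋)
open import Data.Integer using (ℤ; +_; -_; _+_; _*_; _-_; _%ℕ_)
open import Data.Fin using (Fin; toℕ)
open import Data.Vec using (Vec; []; _∷_; zipWith; replicate; count; toList)
open import Data.List using (List; []; _∷_; map; _++_; filter; foldr; length)
open import Relation.Binary.PropositionalEquality using (_≡_)
open import Relation.Nullary.Decidable using (Dec)
open import Data.Bool.Properties using (T?)

-- The ring ℤ[ω], ω = e^{πι/4} (a primitive 8th root of unity), ω⁴ = -1.
-- An element  a₀ + a₁ω + a₂ω² + a₃ω³  (a unique representation; ℤ[ω] ⊂ ℂ).
-- All numbers in the statement (ι = ω², √2 = ω - ω³, e^{πιk/4} = ωᵏ)
-- lie in this subring of ℂ, so equalities can be stated exactly.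

record ℤω : Set where
  constructor ⟨_,_,_,_⟩
  field
    c₀ c₁ c₂ c₃ : ℤ

open ℤω public

0ω 1ω ω ι √2 : ℤω
0ω = ⟨ + 0 , + 0 , + 0 , + 0 ⟩
1ω = ⟨ + 1 , + 0 , + 0 , + 0 ⟩
ω  = ⟨ + 0 , + 1 , + 0 , + 0 ⟩
ι  = ⟨ + 0 , + 0 , + 1 , + 0 ⟩
√2 = ⟨ + 0 , + 1 , + 0 , - (+ 1) ⟩

infixl 6 _⊕ω_ _⊖ω_
infixl 7 _⊛_

_⊕ω_ : ℤω → ℤω → ℤω
⟨ a , b , c , d ⟩ ⊕ω ⟨ a' , b' , c' , d' ⟩ = ⟨ a + a' , b + b' , c + c' , d + d' ⟩

negω : ℤω → ℤω
negω ⟨ a , b , c , d ⟩ = ⟨ - a , - b , - c , - d ⟩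

_⊖ω_ : ℤω → ℤω → ℤω
x ⊖ω y = x ⊕ω negω y

-- multiplication modulo ω⁴ = -1
_⊛_ : ℤω → ℤω → ℤω
⟨ a₀ , a₁ , a₂ , a₃ ⟩ ⊛ ⟨ b₀ , b₁ , b₂ , b₃ ⟩ =
  ⟨ a₀ * b₀ - (a₁ * b₃ + a₂ * b₂ + a₃ * b₁)
  , a₀ * b₁ + a₁ * b₀ - (a₂ * b₃ + a₃ * b₂)
  , a₀ * b₂ + a₁ * b₁ + a₂ * b₀ - a₃ * b₃
  , a₀ * b₃ + a₁ * b₂ + a₂ * b₁ + a₃ * b₀ ⟩

_^ω_ : ℤω → ℕ → ℤω
x ^ω zero  = 1ω
x ^ω suc k = x ⊛ (x ^ω k)

expπι/4 : ℤ → ℤω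
expπι/4 k = ω ^ω (k %ℕ 8)

sumω : List ℤω → ℤω
sumω = foldr _⊕ω_ 0ω

-- GF(2)^E with E = Fin n; vectors are Vec Bool n (true = 1).

allVecs : (n : ℕ) → List (Vec Bool n)
allVecs zero    = [] ∷ []
allVecs (suc n) = map (false ∷_) (allVecs n) ++ map (true ∷_) (allVecs n)

_+v_ : {n : ℕ} → Vec Bool n → Vec Bool n → Vec Bool n
_+v_ = zipWith _xor_

0v : {n : ℕ} → Vec Bool n
0v = replicate _ false

∣supp∣ : {n : ℕ} → Vec Bool n → ℕ
∣supp∣ v = count T? v

isZero : {n : ℕ} → Vec Bool n → Bool
isZero []       = true
isZero (x ∷ xs) = not x ∧ isZero xs

bform : {n : ℕ} → Vec Bool n → Vec Bool n → Bool
bform []       []       = false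
bform (x ∷ xs) (y ∷ ys) = (x ∧ y) xor bform xs ys

_⊆b_ : {n : ℕ} → Vec Bool n → Vec Bool n → Bool
[]       ⊆b []       = true
(x ∷ xs) ⊆b (y ∷ ys) = (not x ∨ y) ∧ (xs ⊆b ys)

_≤lex_ : {n : ℕ} → Vec Bool n → Vec Bool n → Bool
[]           ≤lex []           = true
(false ∷ xs) ≤lex (true  ∷ ys) = true
(true  ∷ xs) ≤lex (false ∷ ys) = false
(false ∷ xs) ≤lex (false ∷ ys) = xs ≤lex ys
(true  ∷ xs) ≤lex (true  ∷ ys) = xs ≤lex ys

-- Linear subspaces of GF(2)^n, given by a (decidable) membership test.
-- Over GF(2), a subspace is a subset containing 0 and closed under +.

record Subspace (n : ℕ) : Set where
  field
    mem    : Vec Bool n → Bool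
    mem-0  : mem 0v ≡ true
    mem-+  : ∀ x y → mem x ≡ true → mem y ≡ true → mem (x +v y) ≡ true

open Subspace public

allB : {A : Set} → (A → Bool) → List A → Bool
allB p = foldr (λ a b → p a ∧ b) true

module _ {n : ℕ} (V : Subspace n) where

  elems : List (Vec Bool n)
  elems = filter (λ v → T? (mem V v)) (allVecs n)

  memPerp : Vec Bool n → Bool
  memPerp w = allB (λ v → not (bform w v)) elems

  memBic : Vec Bool n → Bool
  memBic x = mem V x ∧ memPerp x

  bicycles : List (Vec Bool n)
  bicycles = filter (λ v → T? (memBic v)) (allVecs n)

  dimV : ℕ
  dimV = ⌊log₂ length elems ⌋

  d : ℕ
  d = ⌊log₂ length bicycles ⌋

  qV : Vec Bool n → ℕ
  qV x = ℕ._%_ (∣supp∣ x) 4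

  qVanishes : Set
  qVanishes = ∀ x → memBic x ≡ true → qV x ≡ 0

  -- The quotient W = V/(V ∩ V^⊥): each coset x + (V ∩ V^⊥) is represented by
  -- its lexicographically least element.
  isRep : Vec Bool n → Bool
  isRep x = mem V x ∧ allB (λ y → x ≤lex (x +v y)) bicycles

  reps : List (Vec Bool n)
  reps = filter (λ v → T? (isRep v)) (allVecs n)

  dimW : ℕ
  dimW = dimV ∸ d

  -- Gauss sum  Σ_{w ∈ W} ι^{q̃_V(w)}  with q̃_V(x + V∩V^⊥) = q_V(x)
  gaussSum : ℤω
  gaussSum = sumω (map (λ x → ι ^ω qV x) reps)

  -- σ is Brown's invariant of q̃_V:  Σ_{w∈W} ι^{q̃(w)} = √2^{dim W} e^{πισ/4}
  IsBrownInvariant : Fin 8 → Set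
  IsBrownInvariant σ = gaussSum ≡ (√2 ^ω dimW) ⊛ expπι/4 (+ toℕ σ)

  indep : Vec Bool n → Bool
  indep F = allB (λ v → isZero v ∨ not (v ⊆b F)) elems

  rank : Vec Bool n → ℕ
  rank F = foldr _⊔_ 0
    (map ∣supp∣ (filter (λ G → T? (G ⊆b F ∧ indep G)) (allVecs n)))

  rE : ℕ
  rE = rank (replicate n true)

  tutte : ℤω → ℤω → ℤω
  tutte x y = sumω (map (λ F → ((x ⊖ω 1ω) ^ω (rE ∸ rank F))
                              ⊛ ((y ⊖ω 1ω) ^ω (∣supp∣ F ∸ rank F)))
                        (allVecs n))

-- Put α = -ι - 1 and β = ι - 1, the arguments x - 1 and y - 1 of T_M at (-ι, ι), so that βα = 2 and
-- 1 + α = -ι. Since |V ∩ 2^F| = 2^(|F| - r(F)), multiplying T_M(-ι, ι) by α^(dim V) turns the term of F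
-- into α^(|E| - |F|) |V ∩ 2^F|; exchanging the two sums and applying the binomial theorem over the
-- supersets of each v ∈ V gives α^(dim V) T_M(-ι, ι) = (-ι)^|E| Σ_{v ∈ V} ι^|v|.
-- Picking in each coset of V ∩ V⊥ its lexicographically least element splits this sum as G H, where G is
-- the Gauss sum of q̃_V and H = Σ_{y ∈ V ∩ V⊥} ι^q(y). As q is additive on V ∩ V⊥, H is 2^d(V) if q vanishes
-- there and 0 otherwise. In the first case |Σ_V ι^q|² = |V| H, a character sum, yields |G|² = 2^(dim W);
-- G = x + yι is a Gaussian integer, and x² + y² = 2^m forces G = √2^m ω^σ for an eighth root of unity ω^σ.

module Submission where

open import Defs

module Cyclotomic where

  open import Algebra.Bundles using (CommutativeRing)
  open import Algebra.Structures using (IsCommutativeRing)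
  open import Data.Nat as ℕ using (ℕ; zero; suc)
  import Data.Nat.Properties as ℕ
  open import Data.Nat.DivMod using (_%_; _/_; m≡m%n+[m/n]*n)
  open import Data.Integer as ℤ using (ℤ; +_; -_; _+_; _*_; _-_; _%ℕ_; _/ℕ_)
  import Data.Integer.Properties as ℤ
  open import Data.Integer.DivMod using (a≡a%ℕn+[a/ℕn]*n)
  open import Data.Integer.Tactic.RingSolver using (solve-∀)
  open import Data.Product using (_,_)
  open import Relation.Binary.PropositionalEquality

  ⟨⟩-cong : ∀ {a b c d a′ b′ c′ d′ : ℤ} → a ≡ a′ → b ≡ b′ → c ≡ c′ → d ≡ d′ →
            ⟨ a , b , c , d ⟩ ≡ ⟨ a′ , b′ , c′ , d′ ⟩
  ⟨⟩-cong refl refl refl refl = refl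

  ⊕ω-comm : ∀ x y → x ⊕ω y ≡ y ⊕ω x
  ⊕ω-comm ⟨ a , b , c , d ⟩ ⟨ e , f , g , h ⟩ =
    ⟨⟩-cong (ℤ.+-comm a e) (ℤ.+-comm b f) (ℤ.+-comm c g) (ℤ.+-comm d h)

  ⊕ω-assoc : ∀ x y z → (x ⊕ω y) ⊕ω z ≡ x ⊕ω (y ⊕ω z)
  ⊕ω-assoc ⟨ a , b , c , d ⟩ ⟨ e , f , g , h ⟩ ⟨ i , j , k , l ⟩ =
    ⟨⟩-cong (ℤ.+-assoc a e i) (ℤ.+-assoc b f j) (ℤ.+-assoc c g k) (ℤ.+-assoc d h l)

  ⊕ω-identityˡ : ∀ x → 0ω ⊕ω x ≡ x
  ⊕ω-identityˡ ⟨ a , b , c , d ⟩ =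
    ⟨⟩-cong (ℤ.+-identityˡ a) (ℤ.+-identityˡ b) (ℤ.+-identityˡ c) (ℤ.+-identityˡ d)

  ⊕ω-inverseʳ : ∀ x → x ⊕ω negω x ≡ 0ω
  ⊕ω-inverseʳ ⟨ a , b , c , d ⟩ =
    ⟨⟩-cong (ℤ.+-inverseʳ a) (ℤ.+-inverseʳ b) (ℤ.+-inverseʳ c) (ℤ.+-inverseʳ d)

  ⊛-comm : ∀ x y → x ⊛ y ≡ y ⊛ x
  ⊛-comm ⟨ a , b , c , d ⟩ ⟨ e , f , g , h ⟩ =
    ⟨⟩-cong (e₀ a b c d e f g h) (e₁ a b c d e f g h) (e₂ a b c d e f g h) (e₃ a b c d e f g h)
    where
    e₀ : ∀ a b c d e f g h → a * e - (b * h + c * g + d * f) ≡ e * a - (f * d + g * c + h * b)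
    e₀ = solve-∀
    e₁ : ∀ a b c d e f g h → a * f + b * e - (c * h + d * g) ≡ e * b + f * a - (g * d + h * c)
    e₁ = solve-∀
    e₂ : ∀ a b c d e f g h → a * g + b * f + c * e - d * h ≡ e * c + f * b + g * a - h * d
    e₂ = solve-∀
    e₃ : ∀ a b c d e f g h → a * h + b * g + c * f + d * e ≡ e * d + f * c + g * b + h * a
    e₃ = solve-∀

  ⊛-assoc : ∀ x y z → (x ⊛ y) ⊛ z ≡ x ⊛ (y ⊛ z)
  ⊛-assoc ⟨ a , b , c , d ⟩ ⟨ e , f , g , h ⟩ ⟨ i , j , k , l ⟩ =
    ⟨⟩-cong (e₀ a b c d e f g h i j k l) (e₁ a b c d e f g h i j k l)
            (e₂ a b c d e f g h i j k l) (e₃ a b c d e f g h i j k l)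
    where
    e₀ : ∀ a b c d e f g h i j k l →
      (a * e - (b * h + c * g + d * f)) * i
        - ((a * f + b * e - (c * h + d * g)) * l + (a * g + b * f + c * e - d * h) * k
           + (a * h + b * g + c * f + d * e) * j)
      ≡ a * (e * i - (f * l + g * k + h * j))
        - (b * (e * l + f * k + g * j + h * i) + c * (e * k + f * j + g * i - h * l)
           + d * (e * j + f * i - (g * l + h * k)))
    e₀ = solve-∀
    e₁ : ∀ a b c d e f g h i j k l →
      (a * e - (b * h + c * g + d * f)) * j + (a * f + b * e - (c * h + d * g)) * i
        - ((a * g + b * f + c * e - d * h) * l + (a * h + b * g + c * f + d * e) * k)
      ≡ a * (e * j + f * i - (g * l + h * k)) + b * (e * i - (f * l + g * k + h * j))
        - (c * (e * l + f * k + g * j + h * i) + d * (e * k + f * j + g * i - h * l))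
    e₁ = solve-∀
    e₂ : ∀ a b c d e f g h i j k l →
      (a * e - (b * h + c * g + d * f)) * k + (a * f + b * e - (c * h + d * g)) * j
        + (a * g + b * f + c * e - d * h) * i - (a * h + b * g + c * f + d * e) * l
      ≡ a * (e * k + f * j + g * i - h * l) + b * (e * j + f * i - (g * l + h * k))
        + c * (e * i - (f * l + g * k + h * j)) - d * (e * l + f * k + g * j + h * i)
    e₂ = solve-∀
    e₃ : ∀ a b c d e f g h i j k l →
      (a * e - (b * h + c * g + d * f)) * l + (a * f + b * e - (c * h + d * g)) * k
        + (a * g + b * f + c * e - d * h) * j + (a * h + b * g + c * f + d * e) * i
      ≡ a * (e * l + f * k + g * j + h * i) + b * (e * k + f * j + g * i - h * l)
        + c * (e * j + f * i - (g * l + h * k)) + d * (e * i - (f * l + g * k + h * j))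
    e₃ = solve-∀

  ⊛-distribˡ : ∀ x y z → x ⊛ (y ⊕ω z) ≡ x ⊛ y ⊕ω x ⊛ z
  ⊛-distribˡ ⟨ a , b , c , d ⟩ ⟨ e , f , g , h ⟩ ⟨ i , j , k , l ⟩ =
    ⟨⟩-cong (e₀ a b c d e f g h i j k l) (e₁ a b c d e f g h i j k l)
            (e₂ a b c d e f g h i j k l) (e₃ a b c d e f g h i j k l)
    where
    e₀ : ∀ a b c d e f g h i j k l →
      a * (e + i) - (b * (h + l) + c * (g + k) + d * (f + j))
      ≡ (a * e - (b * h + c * g + d * f)) + (a * i - (b * l + c * k + d * j))
    e₀ = solve-∀
    e₁ : ∀ a b c d e f g h i j k l →
      a * (f + j) + b * (e + i) - (c * (h + l) + d * (g + k))
      ≡ (a * f + b * e - (c * h + d * g)) + (a * j + b * i - (c * l + d * k))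
    e₁ = solve-∀
    e₂ : ∀ a b c d e f g h i j k l →
      a * (g + k) + b * (f + j) + c * (e + i) - d * (h + l)
      ≡ (a * g + b * f + c * e - d * h) + (a * k + b * j + c * i - d * l)
    e₂ = solve-∀
    e₃ : ∀ a b c d e f g h i j k l →
      a * (h + l) + b * (g + k) + c * (f + j) + d * (e + i)
      ≡ (a * h + b * g + c * f + d * e) + (a * l + b * k + c * j + d * i)
    e₃ = solve-∀

  ⊛-identityˡ : ∀ x → 1ω ⊛ x ≡ x
  ⊛-identityˡ ⟨ a , b , c , d ⟩ = ⟨⟩-cong (e₀ a b c d) (e₁ a b c d) (e₂ a b c d) (e₃ a b c d)
    where
    e₀ : ∀ a b c d → + 1 * a - (+ 0 * d + + 0 * c + + 0 * b) ≡ a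
    e₀ = solve-∀
    e₁ : ∀ a b c d → + 1 * b + + 0 * a - (+ 0 * d + + 0 * c) ≡ b
    e₁ = solve-∀
    e₂ : ∀ a b c d → + 1 * c + + 0 * b + + 0 * a - + 0 * d ≡ c
    e₂ = solve-∀
    e₃ : ∀ a b c d → + 1 * d + + 0 * c + + 0 * b + + 0 * a ≡ d
    e₃ = solve-∀

  ℤω-isCommutativeRing : IsCommutativeRing _≡_ _⊕ω_ _⊛_ negω 0ω 1ω
  ℤω-isCommutativeRing = record
    { isRing = record
      { +-isAbelianGroup = record
        { isGroup = record
          { isMonoid = record
            { isSemigroup = record
              { isMagma = record { isEquivalence = isEquivalence ; ∙-cong = cong₂ _⊕ω_ }
              ; assoc   = ⊕ω-assoc }
            ; identity = ⊕ω-identityˡ , λ x → trans (⊕ω-comm x 0ω) (⊕ω-identityˡ x) }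
          ; inverse = (λ x → trans (⊕ω-comm (negω x) x) (⊕ω-inverseʳ x)) , ⊕ω-inverseʳ
          ; ⁻¹-cong = cong negω }
        ; comm = ⊕ω-comm }
      ; *-cong     = cong₂ _⊛_
      ; *-assoc    = ⊛-assoc
      ; *-identity = ⊛-identityˡ , λ x → trans (⊛-comm x 1ω) (⊛-identityˡ x)
      ; distrib    = ⊛-distribˡ
                   , λ x y z → trans (⊛-comm (y ⊕ω z) x)
                       (trans (⊛-distribˡ x y z) (cong₂ _⊕ω_ (⊛-comm x y) (⊛-comm x z))) }
    ; *-comm = ⊛-comm }

  ℤω-commutativeRing : CommutativeRing _ _
  ℤω-commutativeRing = record { isCommutativeRing = ℤω-isCommutativeRing }

  open CommutativeRing ℤω-commutativeRing public
    using (zeroˡ; zeroʳ; *-identityʳ; distribʳ)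
  open import Algebra.Properties.Ring (CommutativeRing.ring ℤω-commutativeRing) public
    using (-‿distribʳ-*; -1*x≈-x)
  open import Algebra.Properties.AbelianGroup (CommutativeRing.+-abelianGroup ℤω-commutativeRing) public
    using (⁻¹-∙-comm)
  open import Algebra.Properties.CommutativeSemigroup
    (CommutativeRing.*-commutativeSemigroup ℤω-commutativeRing) public
    using (interchange; x∙yz≈y∙xz)

  ^ω-homo-⊛ : ∀ x m n → x ^ω (m ℕ.+ n) ≡ x ^ω m ⊛ x ^ω n
  ^ω-homo-⊛ x zero    n = sym (⊛-identityˡ _)
  ^ω-homo-⊛ x (suc m) n = trans (cong (x ⊛_) (^ω-homo-⊛ x m n)) (sym (⊛-assoc x _ _))

  ^ω-distrib-⊛ : ∀ x y n → (x ⊛ y) ^ω n ≡ x ^ω n ⊛ y ^ω n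
  ^ω-distrib-⊛ x y zero    = refl
  ^ω-distrib-⊛ x y (suc n) =
    trans (cong ((x ⊛ y) ⊛_) (^ω-distrib-⊛ x y n)) (interchange x y (x ^ω n) (y ^ω n))

  ^ω-assocʳ : ∀ x m n → (x ^ω m) ^ω n ≡ x ^ω (n ℕ.* m)
  ^ω-assocʳ x m zero    = refl
  ^ω-assocʳ x m (suc n) = trans (cong (x ^ω m ⊛_) (^ω-assocʳ x m n)) (sym (^ω-homo-⊛ x m (n ℕ.* m)))

  1ω^ω : ∀ n → 1ω ^ω n ≡ 1ω
  1ω^ω zero    = refl
  1ω^ω (suc n) = trans (⊛-identityˡ _) (1ω^ω n)

  ^ω-periodic : ∀ x p → x ^ω p ≡ 1ω → ∀ m q → x ^ω (m ℕ.+ q ℕ.* p) ≡ x ^ω m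
  ^ω-periodic x p xᵖ≡1 m q = begin
    x ^ω (m ℕ.+ q ℕ.* p)     ≡⟨ ^ω-homo-⊛ x m (q ℕ.* p) ⟩
    x ^ω m ⊛ x ^ω (q ℕ.* p)  ≡⟨ cong (x ^ω m ⊛_) (sym (^ω-assocʳ x p q)) ⟩
    x ^ω m ⊛ (x ^ω p) ^ω q   ≡⟨ cong (λ y → x ^ω m ⊛ y ^ω q) xᵖ≡1 ⟩
    x ^ω m ⊛ 1ω ^ω q         ≡⟨ cong (x ^ω m ⊛_) (1ω^ω q) ⟩
    x ^ω m ⊛ 1ω              ≡⟨ *-identityʳ _ ⟩
    x ^ω m                   ∎
    where open ≡-Reasoning

  ι^ω⊛-ι^ω≡1ω : ∀ k → ι ^ω k ⊛ negω ι ^ω k ≡ 1ω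
  ι^ω⊛-ι^ω≡1ω k = trans (sym (^ω-distrib-⊛ ι (negω ι) k)) (1ω^ω k)

  ^ω-mod : ∀ x p .{{_ : ℕ.NonZero p}} → x ^ω p ≡ 1ω → ∀ m → x ^ω m ≡ x ^ω (m % p)
  ^ω-mod x p xᵖ≡1 m =
    trans (cong (x ^ω_) (m≡m%n+[m/n]*n m p)) (^ω-periodic x p xᵖ≡1 (m % p) (m / p))

  ι^ω-mod4 : ∀ m → ι ^ω m ≡ ι ^ω (m % 4)
  ι^ω-mod4 = ^ω-mod ι 4 refl

  ω^ω-periodic : ∀ m q → ω ^ω (m ℕ.+ q ℕ.* 8) ≡ ω ^ω m
  ω^ω-periodic = ^ω-periodic ω 8 refl

  +-multiple-of-8 : ∀ b u → + (b ℕ.+ u ℕ.* 8) ≡ + b + + u * + 8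
  +-multiple-of-8 b u = trans (ℤ.pos-+ b (u ℕ.* 8)) (cong (_+_ (+ b)) (ℤ.pos-* u 8))

  ω^ω-cong-mod8 : ∀ a b (t : ℤ) → + a ≡ + b + t * + 8 → ω ^ω a ≡ ω ^ω b
  ω^ω-cong-mod8 a b (+ u) eq =
    trans (cong (ω ^ω_) (ℤ.+-injective (trans eq (sym (+-multiple-of-8 b u))))) (ω^ω-periodic b u)
  ω^ω-cong-mod8 a b ℤ.-[1+ u ] eq =
    sym (trans (cong (ω ^ω_) (ℤ.+-injective (trans b≡a+8u (sym (+-multiple-of-8 a (suc u))))))
               (ω^ω-periodic a (suc u)))
    where
    cancel : ∀ b t → b + - t * + 8 + t * + 8 ≡ b
    cancel = solve-∀
    b≡a+8u : + b ≡ + a + + suc u * + 8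
    b≡a+8u = trans (sym (cancel (+ b) (+ suc u))) (cong (_+ + suc u * + 8) (sym eq))

  expπι/4-≡ω^ω : ∀ k m q → k + + (q ℕ.* 8) ≡ + m → expπι/4 k ≡ ω ^ω m
  expπι/4-≡ω^ω k m q eq = ω^ω-cong-mod8 (k %ℕ 8) m (- (k /ℕ 8) + - + q) r≡m-8[t+q]
    where
    cancel : ∀ r t q → r + t * + 8 + q * + 8 + (- t + - q) * + 8 ≡ r
    cancel = solve-∀
    r+8t+8q≡m : + (k %ℕ 8) + (k /ℕ 8) * + 8 + + q * + 8 ≡ + m
    r+8t+8q≡m = trans (cong₂ _+_ (sym (a≡a%ℕn+[a/ℕn]*n k 8)) (sym (ℤ.pos-* q 8))) eq
    r≡m-8[t+q] : + (k %ℕ 8) ≡ + m + (- (k /ℕ 8) + - + q) * + 8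
    r≡m-8[t+q] = trans (sym (cancel (+ (k %ℕ 8)) (k /ℕ 8) (+ q)))
                       (cong (_+ (- (k /ℕ 8) + - + q) * + 8) r+8t+8q≡m)

  -- conj sends ω to ω⁻¹ = -ω³
  conj : ℤω → ℤω
  conj ⟨ a , b , c , d ⟩ = ⟨ a , - d , - c , - b ⟩

  conj-⊕ω : ∀ x y → conj (x ⊕ω y) ≡ conj x ⊕ω conj y
  conj-⊕ω ⟨ a , b , c , d ⟩ ⟨ e , f , g , h ⟩ =
    ⟨⟩-cong refl (ℤ.neg-distrib-+ d h) (ℤ.neg-distrib-+ c g) (ℤ.neg-distrib-+ b f)

  conj-⊛ : ∀ x y → conj (x ⊛ y) ≡ conj x ⊛ conj y
  conj-⊛ ⟨ a , b , c , d ⟩ ⟨ e , f , g , h ⟩ =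
    ⟨⟩-cong (e₀ a b c d e f g h) (e₁ a b c d e f g h) (e₂ a b c d e f g h) (e₃ a b c d e f g h)
    where
    e₀ : ∀ a b c d e f g h → a * e - (b * h + c * g + d * f) ≡ a * e - (- d * - f + - c * - g + - b * - h)
    e₀ = solve-∀
    e₁ : ∀ a b c d e f g h → - (a * h + b * g + c * f + d * e) ≡ a * - h + - d * e - (- c * - f + - b * - g)
    e₁ = solve-∀
    e₂ : ∀ a b c d e f g h → - (a * g + b * f + c * e - d * h) ≡ a * - g + - d * - h + - c * e - - b * - f
    e₂ = solve-∀
    e₃ : ∀ a b c d e f g h → - (a * f + b * e - (c * h + d * g)) ≡ a * - f + - d * - g + - c * - h + - b * e
    e₃ = solve-∀

  conj-^ω : ∀ x n → conj (x ^ω n) ≡ conj x ^ω n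
  conj-^ω x zero    = refl
  conj-^ω x (suc n) = trans (conj-⊛ x (x ^ω n)) (cong (conj x ⊛_) (conj-^ω x n))

  ⌜_⌝ : ℕ → ℤω
  ⌜ n ⌝ = ⟨ + n , + 0 , + 0 , + 0 ⟩

  ⌜⌝-⊛ : ∀ m x → ⌜ m ⌝ ⊛ x ≡ ⟨ + m * c₀ x , + m * c₁ x , + m * c₂ x , + m * c₃ x ⟩
  ⌜⌝-⊛ m ⟨ a , b , c , d ⟩ = ⟨⟩-cong (e₀ (+ m) a b c d) (e₁ (+ m) a b c d) (e₂ (+ m) a b c d) (e₃ (+ m) a b c d)
    where
    e₀ : ∀ m a b c d → m * a - (+ 0 * d + + 0 * c + + 0 * b) ≡ m * a
    e₀ = solve-∀
    e₁ : ∀ m a b c d → m * b + + 0 * a - (+ 0 * d + + 0 * c) ≡ m * b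
    e₁ = solve-∀
    e₂ : ∀ m a b c d → m * c + + 0 * b + + 0 * a - + 0 * d ≡ m * c
    e₂ = solve-∀
    e₃ : ∀ m a b c d → m * d + + 0 * c + + 0 * b + + 0 * a ≡ m * d
    e₃ = solve-∀

  ⌜⌝-* : ∀ m n → ⌜ m ℕ.* n ⌝ ≡ ⌜ m ⌝ ⊛ ⌜ n ⌝
  ⌜⌝-* m n = sym (trans (⌜⌝-⊛ m ⌜ n ⌝) (⟨⟩-cong (sym (ℤ.pos-* m n)) m*0 m*0 m*0))
    where m*0 = ℤ.*-zeroʳ (+ m)

  ⌜⌝-^ω : ∀ m n → ⌜ m ⌝ ^ω n ≡ ⌜ m ℕ.^ n ⌝
  ⌜⌝-^ω m zero    = refl
  ⌜⌝-^ω m (suc n) = trans (cong (⌜ m ⌝ ⊛_) (⌜⌝-^ω m n)) (sym (⌜⌝-* m (m ℕ.^ n)))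

  ⌜⌝-cancelˡ : ∀ m .{{_ : ℕ.NonZero m}} x y → ⌜ m ⌝ ⊛ x ≡ ⌜ m ⌝ ⊛ y → x ≡ y
  ⌜⌝-cancelˡ (suc m) x y eq =
    ⟨⟩-cong (cancel (cong c₀ eq′)) (cancel (cong c₁ eq′)) (cancel (cong c₂ eq′)) (cancel (cong c₃ eq′))
    where
    eq′ = trans (sym (⌜⌝-⊛ (suc m) x)) (trans eq (⌜⌝-⊛ (suc m) y))
    cancel : ∀ {i j} → + suc m * i ≡ + suc m * j → i ≡ j
    cancel = ℤ.*-cancelˡ-≡ (+ suc m) _ _

  x≡negωx⇒x≡0ω : ∀ x → x ≡ negω x → x ≡ 0ω
  x≡negωx⇒x≡0ω ⟨ a , b , c , d ⟩ eq =
    ⟨⟩-cong (i≡-i⇒i≡0 a (cong c₀ eq)) (i≡-i⇒i≡0 b (cong c₁ eq))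
            (i≡-i⇒i≡0 c (cong c₂ eq)) (i≡-i⇒i≡0 d (cong c₃ eq))
    where
    i≡-i⇒i≡0 : ∀ i → i ≡ - i → i ≡ + 0
    i≡-i⇒i≡0 (+ zero)  _ = refl
    i≡-i⇒i≡0 (+ suc k) ()
    i≡-i⇒i≡0 ℤ.-[1+ k ] ()

module CubeSums where

  open import Algebra.Core using (Op₂)
  open import Algebra.Bundles using (CommutativeSemigroup)
  open import Algebra.Structures using (IsCommutativeMonoid)
  open import Data.Bool using (Bool; true; false; if_then_else_)
  open import Data.Bool.Properties using (T?)
  open import Data.Nat using (zero; suc)
  open import Data.Vec using (Vec; []; _∷_)
  import Data.Vec.Properties as Vec
  open import Data.List using (List; []; _∷_; map; _++_; filter; foldr)
  import Data.List.Properties as List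
  open import Function using (_∘_)
  open import Relation.Nullary using (¬_)
  open import Relation.Binary.PropositionalEquality

  module CubeSum {A : Set} {_∙_ : Op₂ A} {ε : A} (isCM : IsCommutativeMonoid _≡_ _∙_ ε) where

    open IsCommutativeMonoid isCM using (assoc; comm; identityˡ; identityʳ; isCommutativeSemigroup)

    ∙-commutativeSemigroup : CommutativeSemigroup _ _
    ∙-commutativeSemigroup = record { isCommutativeSemigroup = isCommutativeSemigroup }

    open import Algebra.Properties.CommutativeSemigroup ∙-commutativeSemigroup using (interchange)

    ∑ : ∀ n → (Vec Bool n → A) → A
    ∑ zero    f = f []
    ∑ (suc n) f = ∑ n (f ∘ (false ∷_)) ∙ ∑ n (f ∘ (true ∷_))

    ∑-cong : ∀ n {f g : Vec Bool n → A} → (∀ x → f x ≡ g x) → ∑ n f ≡ ∑ n g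
    ∑-cong zero    f≗g = f≗g []
    ∑-cong (suc n) f≗g = cong₂ _∙_ (∑-cong n (f≗g ∘ (false ∷_))) (∑-cong n (f≗g ∘ (true ∷_)))

    ∑-ε : ∀ n → ∑ n (λ _ → ε) ≡ ε
    ∑-ε zero    = refl
    ∑-ε (suc n) = trans (cong₂ _∙_ (∑-ε n) (∑-ε n)) (identityˡ ε)

    ∑-distrib : ∀ n (f g : Vec Bool n → A) → ∑ n (λ x → f x ∙ g x) ≡ ∑ n f ∙ ∑ n g
    ∑-distrib zero    f g = refl
    ∑-distrib (suc n) f g =
      trans (cong₂ _∙_ (∑-distrib n _ _) (∑-distrib n _ _)) (interchange _ _ _ _)

    ∑-swap : ∀ m n (f : Vec Bool m → Vec Bool n → A) →
             ∑ m (λ x → ∑ n (f x)) ≡ ∑ n (λ y → ∑ m (λ x → f x y))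
    ∑-swap zero    n f = refl
    ∑-swap (suc m) n f =
      trans (cong₂ _∙_ (∑-swap m n _) (∑-swap m n _)) (sym (∑-distrib n _ _))

    ∑-translate : ∀ n (f : Vec Bool n → A) c → ∑ n (λ x → f (x +v c)) ≡ ∑ n f
    ∑-translate zero    f []          = refl
    ∑-translate (suc n) f (false ∷ c) =
      cong₂ _∙_ (∑-translate n (f ∘ (false ∷_)) c) (∑-translate n (f ∘ (true ∷_)) c)
    ∑-translate (suc n) f (true ∷ c)  =
      trans (cong₂ _∙_ (∑-translate n (f ∘ (true ∷_)) c) (∑-translate n (f ∘ (false ∷_)) c))
            (comm _ _)

    ∑-delta : ∀ n (f : Vec Bool n → A) a → (∀ x → ¬ x ≡ a → f x ≡ ε) → ∑ n f ≡ f a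
    ∑-delta zero    f []      _ = refl
    ∑-delta (suc n) f (false ∷ a) vanish =
      trans (cong₂ _∙_ (∑-delta n (f ∘ (false ∷_)) a (λ x x≢a → vanish _ (x≢a ∘ Vec.∷-injectiveʳ)))
                       (trans (∑-cong n (λ x → vanish (true ∷ x) λ ())) (∑-ε n)))
            (identityʳ _)
    ∑-delta (suc n) f (true ∷ a) vanish =
      trans (cong₂ _∙_ (trans (∑-cong n (λ x → vanish (false ∷ x) λ ())) (∑-ε n))
                       (∑-delta n (f ∘ (true ∷_)) a (λ x x≢a → vanish _ (x≢a ∘ Vec.∷-injectiveʳ))))
            (identityˡ _)

    ∑-closed : (P : A → Set) → (∀ {x y} → P x → P y → P (x ∙ y)) →
               ∀ n (f : Vec Bool n → A) → (∀ x → P (f x)) → P (∑ n f)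
    ∑-closed P ∙-closed zero    f Pf = Pf []
    ∑-closed P ∙-closed (suc n) f Pf =
      ∙-closed (∑-closed P ∙-closed n _ (Pf ∘ (false ∷_))) (∑-closed P ∙-closed n _ (Pf ∘ (true ∷_)))

    foldr-++ : ∀ xs ys → foldr _∙_ ε (xs ++ ys) ≡ foldr _∙_ ε xs ∙ foldr _∙_ ε ys
    foldr-++ []       ys = sym (identityˡ _)
    foldr-++ (x ∷ xs) ys = trans (cong (x ∙_) (foldr-++ xs ys)) (sym (assoc _ _ _))

    foldr-allVecs : ∀ n (f : Vec Bool n → A) → foldr _∙_ ε (map f (allVecs n)) ≡ ∑ n f
    foldr-allVecs zero    f = identityʳ _
    foldr-allVecs (suc n) f = begin
      foldr _∙_ ε (map f (map (false ∷_) xs ++ map (true ∷_) xs))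
        ≡⟨ cong (foldr _∙_ ε) (List.map-++ f (map (false ∷_) xs) (map (true ∷_) xs)) ⟩
      foldr _∙_ ε (map f (map (false ∷_) xs) ++ map f (map (true ∷_) xs))
        ≡⟨ foldr-++ (map f (map (false ∷_) xs)) _ ⟩
      foldr _∙_ ε (map f (map (false ∷_) xs)) ∙ foldr _∙_ ε (map f (map (true ∷_) xs))
        ≡⟨ cong₂ _∙_ (half false) (half true) ⟩
      ∑ (suc n) f ∎
      where
      open ≡-Reasoning
      xs = allVecs n
      half : ∀ b → foldr _∙_ ε (map f (map (b ∷_) xs)) ≡ ∑ n (f ∘ (b ∷_))
      half b = trans (cong (foldr _∙_ ε) (sym (List.map-∘ xs))) (foldr-allVecs n _)

    foldr-filter : ∀ {B : Set} (p : B → Bool) (f : B → A) xs →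
      foldr _∙_ ε (map f (filter (T? ∘ p) xs)) ≡ foldr _∙_ ε (map (λ x → if p x then f x else ε) xs)
    foldr-filter p f []       = refl
    foldr-filter p f (x ∷ xs) with p x
    ... | true  = cong (f x ∙_) (foldr-filter p f xs)
    ... | false = trans (foldr-filter p f xs) (sym (identityˡ _))

    foldr-filter-allVecs : ∀ n (p : Vec Bool n → Bool) (f : Vec Bool n → A) →
      foldr _∙_ ε (map f (filter (T? ∘ p) (allVecs n))) ≡ ∑ n (λ x → if p x then f x else ε)
    foldr-filter-allVecs n p f = trans (foldr-filter p f (allVecs n)) (foldr-allVecs n _)

  module CubeSumMap
    {A B : Set} {_∙_ : Op₂ A} {ε : A} {_∘′_ : Op₂ B} {ε′ : B}
    (M : IsCommutativeMonoid _≡_ _∙_ ε) (N : IsCommutativeMonoid _≡_ _∘′_ ε′) where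

    open CubeSum M using () renaming (∑ to ∑ᴬ)
    open CubeSum N using () renaming (∑ to ∑ᴮ)

    ∑-map : (h : A → B) → (∀ x y → h (x ∙ y) ≡ h x ∘′ h y) →
            ∀ n (f : Vec Bool n → A) → h (∑ᴬ n f) ≡ ∑ᴮ n (h ∘ f)
    ∑-map h homo zero    f = refl
    ∑-map h homo (suc n) f = trans (homo _ _) (cong₂ _∘′_ (∑-map h homo n _) (∑-map h homo n _))

module BinaryVectors where

  open Cyclotomic
  open import Data.Bool using (Bool; true; false; _∧_; _∨_; not; _xor_; if_then_else_)
  import Data.Bool.Properties as Bool
  open import Data.Nat as ℕ using (ℕ; zero; suc; _≤_; z≤n; s≤s)
  import Data.Nat.Properties as ℕ
  open import Data.Fin using (Fin; zero; suc)
  open import Data.Vec using (Vec; []; _∷_; replicate; lookup; _[_]≔_)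
  import Data.Vec.Properties as Vec
  open import Data.Product using (∃; _×_; _,_)
  open import Data.Sum using (_⊎_; inj₁; inj₂)
  open import Data.Empty using (⊥-elim)
  open import Relation.Binary.PropositionalEquality
  open import Algebra.Bundles using (CommutativeRing)
  open import Algebra.Properties.CommutativeSemigroup
    (CommutativeRing.+-commutativeSemigroup Bool.xor-∧-commutativeRing)
    using () renaming (interchange to xor-interchange)

  private variable n : ℕ

  true≢false : true ≢ false
  true≢false ()

  +v-comm : (x y : Vec Bool n) → x +v y ≡ y +v x
  +v-comm = Vec.zipWith-comm Bool.xor-comm

  +v-assoc : (x y z : Vec Bool n) → (x +v y) +v z ≡ x +v (y +v z)
  +v-assoc = Vec.zipWith-assoc Bool.xor-assoc

  +v-identityʳ : (x : Vec Bool n) → x +v 0v ≡ x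
  +v-identityʳ = Vec.zipWith-identityʳ Bool.xor-identityʳ

  +v-self : (x : Vec Bool n) → x +v x ≡ 0v
  +v-self []      = refl
  +v-self (a ∷ x) = cong₂ _∷_ (Bool.xor-same a) (+v-self x)

  +v-cancelʳ : (x y : Vec Bool n) → (x +v y) +v y ≡ x
  +v-cancelʳ x y = trans (+v-assoc x y y) (trans (cong (x +v_) (+v-self y)) (+v-identityʳ x))

  +v-cancelˡ : (x y : Vec Bool n) → x +v (x +v y) ≡ y
  +v-cancelˡ x y = trans (+v-comm x (x +v y)) (trans (cong (_+v x) (+v-comm x y)) (+v-cancelʳ y x))

  ∣supp∣-≤ : (x : Vec Bool n) → ∣supp∣ x ≤ n
  ∣supp∣-≤ []          = z≤n
  ∣supp∣-≤ (true ∷ x)  = s≤s (∣supp∣-≤ x)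
  ∣supp∣-≤ (false ∷ x) = ℕ.m≤n⇒m≤1+n (∣supp∣-≤ x)

  ∣supp∣-replicate : ∀ n → ∣supp∣ (replicate n true) ≡ n
  ∣supp∣-replicate zero    = refl
  ∣supp∣-replicate (suc n) = cong suc (∣supp∣-replicate n)

  ∣supp∣-0v : ∀ n → ∣supp∣ (0v {n}) ≡ 0
  ∣supp∣-0v zero    = refl
  ∣supp∣-0v (suc n) = ∣supp∣-0v n

  ∣supp∣-remove : (F : Vec Bool n) (i : Fin n) → lookup F i ≡ true →
                  ∣supp∣ F ≡ suc (∣supp∣ (F [ i ]≔ false))
  ∣supp∣-remove (true ∷ F)  zero    _  = refl
  ∣supp∣-remove (true ∷ F)  (suc i) Fᵢ = cong suc (∣supp∣-remove F i Fᵢ)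
  ∣supp∣-remove (false ∷ F) (suc i) Fᵢ = ∣supp∣-remove F i Fᵢ

  isZero⇒≡0v : (x : Vec Bool n) → isZero x ≡ true → x ≡ 0v
  isZero⇒≡0v []          _  = refl
  isZero⇒≡0v (false ∷ x) eq = cong (false ∷_) (isZero⇒≡0v x eq)

  ¬isZero⇒nonzero-coordinate : (x : Vec Bool n) → isZero x ≡ false → ∃ λ i → lookup x i ≡ true
  ¬isZero⇒nonzero-coordinate (true ∷ x)  _  = zero , refl
  ¬isZero⇒nonzero-coordinate (false ∷ x) eq with ¬isZero⇒nonzero-coordinate x eq
  ... | i , xᵢ = suc i , xᵢ

  ∧-true⁻ˡ : ∀ {a b} → a ∧ b ≡ true → a ≡ true
  ∧-true⁻ˡ {true} _ = refl

  ∧-true⁻ʳ : ∀ {a b} → a ∧ b ≡ true → b ≡ true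
  ∧-true⁻ʳ {true} eq = eq

  ⊆b-refl : (x : Vec Bool n) → x ⊆b x ≡ true
  ⊆b-refl []          = refl
  ⊆b-refl (true ∷ x)  = ⊆b-refl x
  ⊆b-refl (false ∷ x) = ⊆b-refl x

  ⊆b-trans : (x y z : Vec Bool n) → x ⊆b y ≡ true → y ⊆b z ≡ true → x ⊆b z ≡ true
  ⊆b-trans []          []         []         _   _   = refl
  ⊆b-trans (false ∷ x) (b ∷ y)    (c ∷ z)    x⊆y y⊆z =
    ⊆b-trans x y z (∧-true⁻ʳ {not false ∨ b} x⊆y) (∧-true⁻ʳ {not b ∨ c} y⊆z)
  ⊆b-trans (true ∷ x)  (true ∷ y) (true ∷ z) x⊆y y⊆z = ⊆b-trans x y z x⊆y y⊆z

  ⊆b-replicate : (x : Vec Bool n) → x ⊆b replicate n true ≡ true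
  ⊆b-replicate []          = refl
  ⊆b-replicate (true ∷ x)  = ⊆b-replicate x
  ⊆b-replicate (false ∷ x) = ⊆b-replicate x

  0v-⊆b : (x : Vec Bool n) → 0v ⊆b x ≡ true
  0v-⊆b []      = refl
  0v-⊆b (b ∷ x) = 0v-⊆b x

  +v-⊆b : (x y F : Vec Bool n) → x ⊆b F ≡ true → y ⊆b F ≡ true → (x +v y) ⊆b F ≡ true
  +v-⊆b []          []          []          _   _   = refl
  +v-⊆b (a ∷ x)     (b ∷ y)     (true ∷ F)  x⊆F y⊆F =
    trans (cong (_∧ ((x +v y) ⊆b F)) (Bool.∨-zeroʳ (not (a xor b))))
          (+v-⊆b x y F (∧-true⁻ʳ {not a ∨ true} x⊆F) (∧-true⁻ʳ {not b ∨ true} y⊆F))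
  +v-⊆b (false ∷ x) (false ∷ y) (false ∷ F) x⊆F y⊆F = +v-⊆b x y F x⊆F y⊆F

  ⊆b⇒∣supp∣-≤ : (x y : Vec Bool n) → x ⊆b y ≡ true → ∣supp∣ x ≤ ∣supp∣ y
  ⊆b⇒∣supp∣-≤ []          []          _   = z≤n
  ⊆b⇒∣supp∣-≤ (false ∷ x) (false ∷ y) x⊆y = ⊆b⇒∣supp∣-≤ x y x⊆y
  ⊆b⇒∣supp∣-≤ (false ∷ x) (true ∷ y)  x⊆y = ℕ.m≤n⇒m≤1+n (⊆b⇒∣supp∣-≤ x y x⊆y)
  ⊆b⇒∣supp∣-≤ (true ∷ x)  (true ∷ y)  x⊆y = s≤s (⊆b⇒∣supp∣-≤ x y x⊆y)

  ⊆b-lookup : (x F : Vec Bool n) (i : Fin n) → x ⊆b F ≡ true → lookup x i ≡ true → lookup F i ≡ true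
  ⊆b-lookup (true ∷ x) (true ∷ F) zero    _   _  = refl
  ⊆b-lookup (a ∷ x)    (b ∷ F)    (suc i) x⊆F xᵢ = ⊆b-lookup x F i (∧-true⁻ʳ {not a ∨ b} x⊆F) xᵢ

  ⊆b-remove : (x F : Vec Bool n) (i : Fin n) → x ⊆b (F [ i ]≔ false) ≡ (x ⊆b F) ∧ not (lookup x i)
  ⊆b-remove (true ∷ x)  (b ∷ F) zero    = sym (Bool.∧-zeroʳ _)
  ⊆b-remove (false ∷ x) (b ∷ F) zero    = sym (Bool.∧-identityʳ _)
  ⊆b-remove (a ∷ x)     (b ∷ F) (suc i) =
    trans (cong ((not a ∨ b) ∧_) (⊆b-remove x F i)) (sym (Bool.∧-assoc (not a ∨ b) _ _))

  remove-⊆b : (F : Vec Bool n) (i : Fin n) → (F [ i ]≔ false) ⊆b F ≡ true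
  remove-⊆b (b ∷ F)     zero    = ⊆b-refl F
  remove-⊆b (true ∷ F)  (suc i) = remove-⊆b F i
  remove-⊆b (false ∷ F) (suc i) = remove-⊆b F i

  ⊆b-or-witness : (F G : Vec Bool n) →
    F ⊆b G ≡ true ⊎ ∃ λ i → lookup F i ≡ true × lookup G i ≡ false
  ⊆b-or-witness []          []          = inj₁ refl
  ⊆b-or-witness (true ∷ F)  (false ∷ G) = inj₂ (zero , refl , refl)
  ⊆b-or-witness (false ∷ F) (b ∷ G)     with ⊆b-or-witness F G
  ... | inj₁ F⊆G          = inj₁ F⊆G
  ... | inj₂ (i , Fᵢ , Gᵢ) = inj₂ (suc i , Fᵢ , Gᵢ)
  ⊆b-or-witness (true ∷ F)  (true ∷ G)  with ⊆b-or-witness F G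
  ... | inj₁ F⊆G          = inj₁ F⊆G
  ... | inj₂ (i , Fᵢ , Gᵢ) = inj₂ (suc i , Fᵢ , Gᵢ)

  search : ∀ n (P : Vec Bool n → Bool) → (∃ λ x → P x ≡ true) ⊎ (∀ x → P x ≡ false)
  search zero    P with P [] in eq
  ... | true  = inj₁ ([] , eq)
  ... | false = inj₂ λ { [] → eq }
  search (suc n) P with search n (λ x → P (false ∷ x)) | search n (λ x → P (true ∷ x))
  ... | inj₁ (x , Px) | _             = inj₁ (false ∷ x , Px)
  ... | inj₂ _        | inj₁ (x , Px) = inj₁ (true ∷ x , Px)
  ... | inj₂ none₀    | inj₂ none₁    = inj₂ λ { (false ∷ x) → none₀ x ; (true ∷ x) → none₁ x }

  ≤lex-antisym : (x y : Vec Bool n) → x ≤lex y ≡ true → y ≤lex x ≡ true → x ≡ y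
  ≤lex-antisym []          []          _   _   = refl
  ≤lex-antisym (false ∷ x) (false ∷ y) x≤y y≤x = cong (false ∷_) (≤lex-antisym x y x≤y y≤x)
  ≤lex-antisym (true ∷ x)  (true ∷ y)  x≤y y≤x = cong (true ∷_) (≤lex-antisym x y x≤y y≤x)

  ≤lex-minimum : ∀ n (P : Vec Bool n → Bool) x₀ → P x₀ ≡ true →
    ∃ λ m → P m ≡ true × (∀ z → P z ≡ true → m ≤lex z ≡ true)
  ≤lex-minimum zero    P []            Px₀ = [] , Px₀ , λ { [] _ → refl }
  ≤lex-minimum (suc n) P (b ∷ x₀) Px₀ with search n (λ x → P (false ∷ x))
  ... | inj₁ (x , Px) with ≤lex-minimum n (λ x → P (false ∷ x)) x Px
  ...   | m , Pm , least = false ∷ m , Pm , λ { (false ∷ z) Pz → least z Pz ; (true ∷ z) _ → refl }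
  ≤lex-minimum (suc n) P (false ∷ x₀) Px₀ | inj₂ none₀ with trans (sym Px₀) (none₀ x₀)
  ... | ()
  ≤lex-minimum (suc n) P (true ∷ x₀) Px₀ | inj₂ none₀ with ≤lex-minimum n (λ x → P (true ∷ x)) x₀ Px₀
  ... | m , Pm , least = true ∷ m , Pm , λ
    { (false ∷ z) Pz → ⊥-elim (true≢false (trans (sym Pz) (none₀ z))) ; (true ∷ z) Pz → least z Pz }

  bform-+v : (x y z : Vec Bool n) → bform (x +v y) z ≡ bform x z xor bform y z
  bform-+v []      []      []      = refl
  bform-+v (a ∷ x) (b ∷ y) (c ∷ z) =
    trans (cong₂ _xor_ (Bool.∧-distribʳ-xor c a b) (bform-+v x y z))
          (xor-interchange (a ∧ c) (b ∧ c) (bform x z) (bform y z))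

  bform-comm : (x y : Vec Bool n) → bform x y ≡ bform y x
  bform-comm []      []      = refl
  bform-comm (a ∷ x) (b ∷ y) = cong₂ _xor_ (Bool.∧-comm a b) (bform-comm x y)

  bform-0v : (x : Vec Bool n) → bform 0v x ≡ false
  bform-0v []      = refl
  bform-0v (b ∷ x) = bform-0v x

  sgn : Bool → ℤω
  sgn b = if b then negω 1ω else 1ω

  sgn-not : ∀ b → sgn (not b) ≡ negω (sgn b)
  sgn-not true  = refl
  sgn-not false = refl

  sgn-⊛-sgn : ∀ b → sgn b ⊛ sgn b ≡ 1ω
  sgn-⊛-sgn true  = refl
  sgn-⊛-sgn false = refl

  -- |x| + |y| = |x +v y| + 2 |x ∩ y|, and ι² = -1
  ι^ω-∣supp∣-+v : (x y : Vec Bool n) →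
    ι ^ω (∣supp∣ x ℕ.+ ∣supp∣ y) ≡ ι ^ω ∣supp∣ (x +v y) ⊛ sgn (bform x y)
  ι^ω-∣supp∣-+v []          []          = refl
  ι^ω-∣supp∣-+v (false ∷ x) (false ∷ y) = ι^ω-∣supp∣-+v x y
  ι^ω-∣supp∣-+v (true ∷ x)  (false ∷ y) =
    trans (cong (ι ⊛_) (ι^ω-∣supp∣-+v x y)) (sym (⊛-assoc ι (ι ^ω ∣supp∣ (x +v y)) (sgn (bform x y))))
  ι^ω-∣supp∣-+v (false ∷ x) (true ∷ y)  =
    trans (cong (ι ^ω_) (ℕ.+-suc (∣supp∣ x) (∣supp∣ y)))
          (trans (cong (ι ⊛_) (ι^ω-∣supp∣-+v x y)) (sym (⊛-assoc ι (ι ^ω ∣supp∣ (x +v y)) (sgn (bform x y)))))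
  ι^ω-∣supp∣-+v (true ∷ x)  (true ∷ y)  = begin
    ι ⊛ ι ^ω (∣supp∣ x ℕ.+ suc (∣supp∣ y))  ≡⟨ cong (λ k → ι ⊛ ι ^ω k) (ℕ.+-suc (∣supp∣ x) (∣supp∣ y)) ⟩
    ι ⊛ (ι ⊛ ι ^ω (∣supp∣ x ℕ.+ ∣supp∣ y))  ≡⟨ sym (⊛-assoc ι ι (ι ^ω (∣supp∣ x ℕ.+ ∣supp∣ y))) ⟩
    negω 1ω ⊛ ι ^ω (∣supp∣ x ℕ.+ ∣supp∣ y)  ≡⟨ cong (negω 1ω ⊛_) (ι^ω-∣supp∣-+v x y) ⟩
    negω 1ω ⊛ (X ⊛ sgn (bform x y))          ≡⟨ x∙yz≈y∙xz (negω 1ω) X (sgn (bform x y)) ⟩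
    X ⊛ (negω 1ω ⊛ sgn (bform x y))          ≡⟨ cong (X ⊛_) (trans (-1*x≈-x _) (sym (sgn-not (bform x y)))) ⟩
    X ⊛ sgn (not (bform x y))                ∎
    where
    open ≡-Reasoning
    X = ι ^ω ∣supp∣ (x +v y)

module Counting where

  open Cyclotomic
  open CubeSums
  open BinaryVectors
  open import Data.Bool using (Bool; true; false; _∧_; not; _xor_; if_then_else_)
  open import Data.Bool.Properties using (T?)
  import Data.Bool.Properties as Bool
  open import Data.Nat as ℕ using (ℕ; zero; suc; _≤_; _∸_; _^_; _*_; _+_; z≤n)
  import Data.Nat.Properties as ℕ
  open import Data.Nat.Logarithm using (⌊log₂_⌋; ⌊log₂⌋-mono-≤; ⌊log₂[2^n]⌋≡n)
  open import Data.Vec using (Vec; []; _∷_; lookup; _[_]≔_)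
  import Data.Vec.Properties as Vec
  open import Data.List using (List; []; _∷_; map; filter; foldr; length)
  open import Data.Product using (∃; _×_; _,_)
  open import Data.Sum using (inj₁; inj₂)
  open import Data.Empty using (⊥-elim)
  open import Function using (_∘_)
  open import Relation.Nullary using (¬_)
  open import Relation.Binary.PropositionalEquality

  private variable n : ℕ

  open CubeSum ℕ.+-0-isCommutativeMonoid public using () renaming
    (∑ to ∑ℕ; ∑-cong to ∑ℕ-cong; ∑-ε to ∑ℕ-0; ∑-distrib to ∑ℕ-distrib;
     ∑-translate to ∑ℕ-translate; ∑-delta to ∑ℕ-delta; foldr-filter-allVecs to sum-filter-allVecs)
  open CubeSum Bool.∧-isCommutativeMonoid public using () renaming
    (∑ to ⋀; ∑-cong to ⋀-cong; ∑-ε to ⋀-true; foldr-filter-allVecs to allB-filter-allVecs′)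
  open CubeSum ℕ.⊔-0-isCommutativeMonoid public using () renaming
    (∑ to ⨆; foldr-filter-allVecs to max-filter-allVecs)

  ⋀-elim : ∀ n (p : Vec Bool n → Bool) → ⋀ n p ≡ true → ∀ x → p x ≡ true
  ⋀-elim zero    p all []          = all
  ⋀-elim (suc n) p all (false ∷ x) = ⋀-elim n _ (∧-true⁻ˡ all) x
  ⋀-elim (suc n) p all (true ∷ x)  = ⋀-elim n _ (∧-true⁻ʳ {⋀ n (p ∘ (false ∷_))} all) x

  allB-filter-allVecs : ∀ n (q p : Vec Bool n → Bool) →
    allB p (filter (T? ∘ q) (allVecs n)) ≡ ⋀ n (λ x → if q x then p x else true)
  allB-filter-allVecs n q p = trans (allB-as-foldr (filter (T? ∘ q) (allVecs n))) (allB-filter-allVecs′ n q p)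
    where
    allB-as-foldr : ∀ xs → allB p xs ≡ foldr _∧_ true (map p xs)
    allB-as-foldr []       = refl
    allB-as-foldr (x ∷ xs) = cong (p x ∧_) (allB-as-foldr xs)

  allB-filter-intro : ∀ n (q p : Vec Bool n → Bool) → (∀ x → q x ≡ true → p x ≡ true) →
    allB p (filter (T? ∘ q) (allVecs n)) ≡ true
  allB-filter-intro n q p q⇒p =
    trans (allB-filter-allVecs n q p) (trans (⋀-cong n pointwise) (⋀-true n))
    where
    pointwise : ∀ x → (if q x then p x else true) ≡ true
    pointwise x with q x in qx
    ... | true  = q⇒p x qx
    ... | false = refl

  allB-filter-elim : ∀ n (q p : Vec Bool n → Bool) → allB p (filter (T? ∘ q) (allVecs n)) ≡ true →
    ∀ x → q x ≡ true → p x ≡ true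
  allB-filter-elim n q p all x qx =
    subst (λ b → (if b then p x else true) ≡ true) qx
          (⋀-elim n _ (trans (sym (allB-filter-allVecs n q p)) all) x)

  ⨆-upper : ∀ n (f : Vec Bool n → ℕ) x → f x ≤ ⨆ n f
  ⨆-upper zero    f []          = ℕ.≤-refl
  ⨆-upper (suc n) f (false ∷ x) = ℕ.≤-trans (⨆-upper n _ x) (ℕ.m≤m⊔n _ _)
  ⨆-upper (suc n) f (true ∷ x)  = ℕ.≤-trans (⨆-upper n _ x) (ℕ.m≤n⊔m _ _)

  ⨆-least : ∀ n (f : Vec Bool n → ℕ) b → (∀ x → f x ≤ b) → ⨆ n f ≤ b
  ⨆-least zero    f b f≤b = f≤b []
  ⨆-least (suc n) f b f≤b = ℕ.⊔-lub (⨆-least n _ b (f≤b ∘ _)) (⨆-least n _ b (f≤b ∘ _))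

  𝟙 : Bool → ℕ
  𝟙 b = if b then 1 else 0

  card : (Vec Bool n → Bool) → ℕ
  card {n} p = ∑ℕ n (𝟙 ∘ p)

  card-cong : (p q : Vec Bool n → Bool) → (∀ x → p x ≡ q x) → card p ≡ card q
  card-cong {n} p q p≗q = ∑ℕ-cong n (cong 𝟙 ∘ p≗q)

  card-mono : ∀ n (p q : Vec Bool n → Bool) → (∀ x → p x ≡ true → q x ≡ true) → card p ≤ card q
  card-mono zero    p q p⇒q with p [] in eq
  ... | false = z≤n
  ... | true  rewrite p⇒q [] eq = ℕ.≤-refl
  card-mono (suc n) p q p⇒q =
    ℕ.+-mono-≤ (card-mono n _ _ (p⇒q ∘ (false ∷_))) (card-mono n _ _ (p⇒q ∘ (true ∷_)))

  length-filter-allVecs : ∀ n (p : Vec Bool n → Bool) → length (filter (T? ∘ p) (allVecs n)) ≡ card p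
  length-filter-allVecs n p = trans (length-as-sum (filter (T? ∘ p) (allVecs n))) (sum-filter-allVecs n p (λ _ → 1))
    where
    length-as-sum : ∀ {A : Set} (xs : List A) → length xs ≡ foldr _+_ 0 (map (λ _ → 1) xs)
    length-as-sum []       = refl
    length-as-sum (x ∷ xs) = cong suc (length-as-sum xs)

  2^-cancel-≤ : ∀ a b → 2 ^ a ≤ 2 ^ b → a ≤ b
  2^-cancel-≤ a b le = subst₂ _≤_ (⌊log₂[2^n]⌋≡n a) (⌊log₂[2^n]⌋≡n b) (⌊log₂⌋-mono-≤ le)

  restrict : Subspace n → Vec Bool n → Subspace n
  restrict U F = record
    { mem   = λ x → mem U x ∧ x ⊆b F
    ; mem-0 = cong₂ _∧_ (mem-0 U) (0v-⊆b F)
    ; mem-+ = λ x y x∈ y∈ → cong₂ _∧_ (mem-+ U x y (∧-true⁻ˡ x∈) (∧-true⁻ˡ y∈))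
                                     (+v-⊆b x y F (∧-true⁻ʳ {mem U x} x∈) (∧-true⁻ʳ {mem U y} y∈)) }

  mem-restrict-remove : ∀ (U : Subspace n) F i x →
    mem (restrict U (F [ i ]≔ false)) x ≡ mem (restrict U F) x ∧ not (lookup x i)
  mem-restrict-remove U F i x =
    trans (cong (mem U x ∧_) (⊆b-remove x F i)) (sym (Bool.∧-assoc (mem U x) (x ⊆b F) _))

  mem-+v-cancel : ∀ (U : Subspace n) x u → mem U u ≡ true → mem U (x +v u) ≡ mem U x
  mem-+v-cancel U x u u∈ with mem U x in x∈ | mem U (x +v u) in x+u∈
  ... | true  | true  = refl
  ... | false | false = refl
  ... | true  | false = ⊥-elim (true≢false (trans (sym (mem-+ U x u x∈ u∈)) x+u∈))
  ... | false | true  =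
    ⊥-elim (true≢false (trans (sym (trans (cong (mem U) (sym (+v-cancelʳ x u))) (mem-+ U _ u x+u∈ u∈))) x∈))

  -- translation by u swaps the two halves {x ∈ U | xᵢ = 0} and {x ∈ U | xᵢ = 1}
  card-halve : ∀ {n} (U : Subspace n) i u → mem U u ≡ true → lookup u i ≡ true →
    card (mem U) ≡ 2 * card (λ x → mem U x ∧ not (lookup x i))
  card-halve {n} U i u u∈ uᵢ = begin
    card (mem U)                      ≡⟨ ∑ℕ-cong n split ⟩
    ∑ℕ n (λ x → 𝟙 (even x) + 𝟙 (odd x)) ≡⟨ ∑ℕ-distrib n _ _ ⟩
    card even + card odd              ≡⟨ cong (card even +_) odd≡even ⟩
    card even + card even             ≡⟨ cong (card even +_) (sym (ℕ.+-identityʳ _)) ⟩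
    2 * card even                     ∎
    where
    open ≡-Reasoning
    even odd : Vec Bool n → Bool
    even x = mem U x ∧ not (lookup x i)
    odd  x = mem U x ∧ lookup x i
    split : ∀ x → 𝟙 (mem U x) ≡ 𝟙 (even x) + 𝟙 (odd x)
    split x with mem U x | lookup x i
    ... | true  | true  = refl
    ... | true  | false = refl
    ... | false | _     = refl
    odd≡even : card odd ≡ card even
    odd≡even = trans (sym (∑ℕ-translate n (𝟙 ∘ odd) u)) (∑ℕ-cong n swap)
      where
      swap : ∀ x → 𝟙 (odd (x +v u)) ≡ 𝟙 (even x)
      swap x rewrite mem-+v-cancel U x u u∈ | Vec.lookup-zipWith _xor_ i x u | uᵢ with lookup x i
      ... | true  = refl
      ... | false = refl

  card-≤-double : ∀ {n} (U : Subspace n) i → card (mem U) ≤ 2 * card (λ x → mem U x ∧ not (lookup x i))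
  card-≤-double {n} U i with search n (λ u → mem U u ∧ lookup u i)
  ... | inj₁ (u , u∈∧uᵢ) = ℕ.≤-reflexive (card-halve U i u (∧-true⁻ˡ u∈∧uᵢ) (∧-true⁻ʳ {mem U u} u∈∧uᵢ))
  ... | inj₂ none = ℕ.≤-trans (ℕ.≤-reflexive (card-cong _ _ same)) (ℕ.m≤m+n _ _)
    where
    same : ∀ x → mem U x ≡ (mem U x ∧ not (lookup x i))
    same x with mem U x in x∈ | lookup x i in xᵢ
    ... | false | _     = refl
    ... | true  | false = refl
    ... | true  | true  = ⊥-elim (true≢false (trans (sym (cong₂ _∧_ x∈ xᵢ)) (none x)))

  Independent : Subspace n → Vec Bool n → Set
  Independent U G = ∀ v → mem U v ≡ true → v ⊆b G ≡ true → isZero v ≡ true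

  card-restrict-independent : ∀ {n} (U : Subspace n) G → Independent U G → card (mem (restrict U G)) ≡ 1
  card-restrict-independent {n} U G indep =
    trans (∑ℕ-delta n _ 0v only-0v) (cong 𝟙 (mem-0 (restrict U G)))
    where
    only-0v : ∀ x → ¬ x ≡ 0v → 𝟙 (mem U x ∧ x ⊆b G) ≡ 0
    only-0v x x≢0 with mem U x in x∈ | x ⊆b G in x⊆G
    ... | true  | true  = ⊥-elim (x≢0 (isZero⇒≡0v x (indep x x∈ x⊆G)))
    ... | true  | false = refl
    ... | false | _     = refl

  2*2^[m∸n]≡2^[1+m∸n] : ∀ m n → n ≤ m → 2 * 2 ^ (m ∸ n) ≡ 2 ^ (suc m ∸ n)
  2*2^[m∸n]≡2^[1+m∸n] m n n≤m = cong (2 ^_) (sym (ℕ.+-∸-assoc 1 n≤m))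

  record Basis (U : Subspace n) (F : Vec Bool n) : Set where
    field
      G           : Vec Bool n
      G⊆F         : G ⊆b F ≡ true
      independent : Independent U G
      card≡       : card (mem (restrict U F)) ≡ 2 ^ (∣supp∣ F ∸ ∣supp∣ G)

  card-restrict-halve : ∀ (U : Subspace n) F v → mem (restrict U F) v ≡ true → isZero v ≡ false →
    ∃ λ i → lookup F i ≡ true × card (mem (restrict U F)) ≡ 2 * card (mem (restrict U (F [ i ]≔ false)))
  card-restrict-halve U F v v∈ v≢0 with ¬isZero⇒nonzero-coordinate v v≢0
  ... | i , vᵢ = i , ⊆b-lookup v F i (∧-true⁻ʳ {mem U v} v∈) vᵢ ,
    trans (card-halve (restrict U F) i v v∈ vᵢ) (cong (2 *_) (sym (card-cong _ _ (mem-restrict-remove U F i))))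

  basis : ∀ {n} (U : Subspace n) F → Basis U F
  basis {n} U F = go (∣supp∣ F) F refl
    where
    go : ∀ k F → ∣supp∣ F ≡ k → Basis U F
    go k F ∣F∣≡k with search n (λ v → mem (restrict U F) v ∧ not (isZero v))
    ... | inj₂ none = record
      { G = F ; G⊆F = ⊆b-refl F ; independent = F-independent
      ; card≡ = trans (card-restrict-independent U F F-independent) (cong (2 ^_) (sym (ℕ.n∸n≡0 (∣supp∣ F)))) }
      where
      F-independent : Independent U F
      F-independent v v∈ v⊆F with isZero v in v≡0
      ... | true  = refl
      ... | false = ⊥-elim (true≢false (trans (sym (cong₂ _∧_ (cong₂ _∧_ v∈ v⊆F) (cong not v≡0))) (none v)))
    ... | inj₁ (v , v∈∧v≢0)
      with card-restrict-halve U F v (∧-true⁻ˡ v∈∧v≢0) (Bool.not-injective (∧-true⁻ʳ {mem (restrict U F) v} v∈∧v≢0))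
    ... | i , Fᵢ , halve with k | trans (sym ∣F∣≡k) (∣supp∣-remove F i Fᵢ)
    ...   | suc k′ | 1+k′≡1+∣F′∣ = record
      { G = B.G ; G⊆F = ⊆b-trans B.G F′ F B.G⊆F (remove-⊆b F i) ; independent = B.independent
      ; card≡ = begin
          card (mem (restrict U F))          ≡⟨ halve ⟩
          2 * card (mem (restrict U F′))     ≡⟨ cong (2 *_) B.card≡ ⟩
          2 * 2 ^ (∣supp∣ F′ ∸ ∣supp∣ B.G)   ≡⟨ 2*2^[m∸n]≡2^[1+m∸n] _ _ (⊆b⇒∣supp∣-≤ B.G F′ B.G⊆F) ⟩
          2 ^ (suc (∣supp∣ F′) ∸ ∣supp∣ B.G) ≡⟨ cong (λ m → 2 ^ (m ∸ ∣supp∣ B.G)) (sym (∣supp∣-remove F i Fᵢ)) ⟩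
          2 ^ (∣supp∣ F ∸ ∣supp∣ B.G)        ∎ }
      where
      open ≡-Reasoning
      F′ = F [ i ]≔ false
      module B = Basis (go k′ F′ (ℕ.suc-injective (sym 1+k′≡1+∣F′∣)))

  card-restrict-≤ : ∀ {n} (U : Subspace n) F G → G ⊆b F ≡ true →
    card (mem (restrict U F)) ≤ 2 ^ (∣supp∣ F ∸ ∣supp∣ G) * card (mem (restrict U G))
  card-restrict-≤ {n} U F G = go (∣supp∣ F) F refl
    where
    open ℕ.≤-Reasoning
    go : ∀ k F → ∣supp∣ F ≡ k → G ⊆b F ≡ true →
         card (mem (restrict U F)) ≤ 2 ^ (∣supp∣ F ∸ ∣supp∣ G) * card (mem (restrict U G))
    go k F ∣F∣≡k G⊆F with ⊆b-or-witness F G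
    ... | inj₁ F⊆G = begin
      card (mem (restrict U F))  ≡⟨ card-cong _ _ (λ x → cong (mem U x ∧_) (same-subsets x)) ⟩
      card (mem (restrict U G))  ≤⟨ ℕ.m≤n*m (card (mem (restrict U G))) (2 ^ (∣supp∣ F ∸ ∣supp∣ G)) {{ℕ.m^n≢0 2 (∣supp∣ F ∸ ∣supp∣ G)}} ⟩
      2 ^ (∣supp∣ F ∸ ∣supp∣ G) * card (mem (restrict U G)) ∎
      where
      same-subsets : ∀ x → x ⊆b F ≡ x ⊆b G
      same-subsets x with x ⊆b F in x⊆F | x ⊆b G in x⊆G
      ... | true  | true  = refl
      ... | false | false = refl
      ... | true  | false = ⊥-elim (true≢false (trans (sym (⊆b-trans x F G x⊆F F⊆G)) x⊆G))
      ... | false | true  = ⊥-elim (true≢false (trans (sym (⊆b-trans x G F x⊆G G⊆F)) x⊆F))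
    ... | inj₂ (i , Fᵢ , Gᵢ) with k | trans (sym ∣F∣≡k) (∣supp∣-remove F i Fᵢ)
    ...   | suc k′ | 1+k′≡1+∣F′∣ = begin
      card (mem (restrict U F))
        ≤⟨ card-≤-double (restrict U F) i ⟩
      2 * card (λ x → mem (restrict U F) x ∧ not (lookup x i))
        ≡⟨ cong (2 *_) (sym (card-cong _ _ (mem-restrict-remove U F i))) ⟩
      2 * card (mem (restrict U F′))
        ≤⟨ ℕ.*-monoʳ-≤ 2 (go k′ F′ (ℕ.suc-injective (sym 1+k′≡1+∣F′∣)) G⊆F′) ⟩
      2 * (2 ^ (∣supp∣ F′ ∸ ∣supp∣ G) * card (mem (restrict U G)))
        ≡⟨ sym (ℕ.*-assoc 2 (2 ^ (∣supp∣ F′ ∸ ∣supp∣ G)) (card (mem (restrict U G)))) ⟩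
      2 * 2 ^ (∣supp∣ F′ ∸ ∣supp∣ G) * card (mem (restrict U G))
        ≡⟨ cong (_* card (mem (restrict U G))) (2*2^[m∸n]≡2^[1+m∸n] _ _ (⊆b⇒∣supp∣-≤ G F′ G⊆F′)) ⟩
      2 ^ (suc (∣supp∣ F′) ∸ ∣supp∣ G) * card (mem (restrict U G))
        ≡⟨ cong (λ m → 2 ^ (m ∸ ∣supp∣ G) * card (mem (restrict U G))) (sym (∣supp∣-remove F i Fᵢ)) ⟩
      2 ^ (∣supp∣ F ∸ ∣supp∣ G) * card (mem (restrict U G)) ∎
      where
      F′ = F [ i ]≔ false
      G⊆F′ : G ⊆b F′ ≡ true
      G⊆F′ = trans (⊆b-remove G F i) (cong₂ _∧_ G⊆F (cong not Gᵢ))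

module MatroidRank where

  open BinaryVectors
  open Counting
  open import Data.Bool using (Bool; true; false; _∧_; _∨_; not; if_then_else_)
  import Data.Bool.Properties as Bool
  open import Data.Nat as ℕ using (ℕ; _≤_; _∸_; _^_; z≤n)
  import Data.Nat.Properties as ℕ
  open import Data.Nat.Logarithm using (⌊log₂_⌋; ⌊log₂[2^n]⌋≡n)
  open import Data.Vec using (Vec; replicate)
  open import Data.Product using (∃; _,_)
  open import Relation.Binary.PropositionalEquality

  card-restrict-replicate : ∀ {n} (U : Subspace n) → card (mem (restrict U (replicate n true))) ≡ card (mem U)
  card-restrict-replicate U = card-cong _ _ λ x → trans (cong (mem U x ∧_) (⊆b-replicate x)) (Bool.∧-identityʳ _)

  card-subspace-power-of-2 : ∀ {n} (U : Subspace n) → ∃ λ k → card (mem U) ≡ 2 ^ k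
  card-subspace-power-of-2 {n} U = ∣supp∣ E ∸ ∣supp∣ (Basis.G B) , trans (sym (card-restrict-replicate U)) (Basis.card≡ B)
    where
    E = replicate n true
    B = basis U E

  log₂-card-subspace : ∀ {n} (U : Subspace n) → card (mem U) ≡ 2 ^ ⌊log₂ card (mem U) ⌋
  log₂-card-subspace U with card-subspace-power-of-2 U
  ... | k , ∣U∣≡2ᵏ = trans ∣U∣≡2ᵏ (cong (2 ^_) (sym (trans (cong ⌊log₂_⌋ ∣U∣≡2ᵏ) (⌊log₂[2^n]⌋≡n k))))

  module _ {n : ℕ} (V : Subspace n) where

    indep⇒Independent : ∀ G → indep V G ≡ true → Independent V G
    indep⇒Independent G G-indep v v∈ v⊆G =
      trans (sym (Bool.∨-identityʳ (isZero v)))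
            (subst (λ b → isZero v ∨ not b ≡ true) v⊆G (allB-filter-elim n (mem V) _ G-indep v v∈))

    Independent⇒indep : ∀ G → Independent V G → indep V G ≡ true
    Independent⇒indep G G-indep = allB-filter-intro n (mem V) _ zero-or-outside
      where
      zero-or-outside : ∀ v → mem V v ≡ true → isZero v ∨ not (v ⊆b G) ≡ true
      zero-or-outside v v∈ with v ⊆b G in v⊆G
      ... | false = Bool.∨-zeroʳ (isZero v)
      ... | true  = cong (_∨ false) (G-indep v v∈ v⊆G)

    rank-as-⨆ : ∀ F → rank V F ≡ ⨆ n (λ G → if G ⊆b F ∧ indep V G then ∣supp∣ G else 0)
    rank-as-⨆ F = max-filter-allVecs n (λ G → G ⊆b F ∧ indep V G) ∣supp∣

    Independent⇒≤rank : ∀ F G → G ⊆b F ≡ true → Independent V G → ∣supp∣ G ≤ rank V F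
    Independent⇒≤rank F G G⊆F G-indep = subst (∣supp∣ G ≤_) (sym (rank-as-⨆ F))
      (subst (λ b → (if b then ∣supp∣ G else 0) ≤ ⨆ n size) (cong₂ _∧_ G⊆F (Independent⇒indep G G-indep))
             (⨆-upper n size G))
      where
      size : Vec Bool n → ℕ
      size H = if H ⊆b F ∧ indep V H then ∣supp∣ H else 0

    -- an independent H ⊆ F satisfies 2^(|F|-|G|) = |V|F| ≤ 2^(|F|-|H|) |V|H| = 2^(|F|-|H|)
    rank≡∣basis∣ : ∀ F (B : Basis V F) → rank V F ≡ ∣supp∣ (Basis.G B)
    rank≡∣basis∣ F B = ℕ.≤-antisym
      (subst (_≤ ∣supp∣ G) (sym (rank-as-⨆ F)) (⨆-least n _ _ bounded))
      (Independent⇒≤rank F G G⊆F independent)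
      where
      open Basis B
      bounded : ∀ H → (if H ⊆b F ∧ indep V H then ∣supp∣ H else 0) ≤ ∣supp∣ G
      bounded H with H ⊆b F in H⊆F | indep V H in H-indep
      ... | false | _     = z≤n
      ... | true  | false = z≤n
      ... | true  | true  = subst₂ _≤_ (ℕ.m∸[m∸n]≡n ∣H∣≤∣F∣) (ℕ.m∸[m∸n]≡n ∣G∣≤∣F∣)
                                      (ℕ.∸-monoʳ-≤ (∣supp∣ F) (2^-cancel-≤ (∣supp∣ F ∸ ∣supp∣ G) (∣supp∣ F ∸ ∣supp∣ H) powers))
        where
        ∣H∣≤∣F∣ = ⊆b⇒∣supp∣-≤ H F H⊆F
        ∣G∣≤∣F∣ = ⊆b⇒∣supp∣-≤ G F G⊆F
        powers : 2 ^ (∣supp∣ F ∸ ∣supp∣ G) ≤ 2 ^ (∣supp∣ F ∸ ∣supp∣ H)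
        powers = subst₂ _≤_ card≡
          (trans (cong (2 ^ (∣supp∣ F ∸ ∣supp∣ H) ℕ.*_)
                       (card-restrict-independent V H (indep⇒Independent H H-indep)))
                 (ℕ.*-identityʳ _))
          (card-restrict-≤ V F H H⊆F)

    rank-≤-∣supp∣ : ∀ F → rank V F ≤ ∣supp∣ F
    rank-≤-∣supp∣ F = subst (_≤ ∣supp∣ F) (sym (rank≡∣basis∣ F B)) (⊆b⇒∣supp∣-≤ (Basis.G B) F (Basis.G⊆F B))
      where B = basis V F

    card-restrict-rank : ∀ F → card (mem (restrict V F)) ≡ 2 ^ (∣supp∣ F ∸ rank V F)
    card-restrict-rank F = trans (Basis.card≡ B) (cong (λ r → 2 ^ (∣supp∣ F ∸ r)) (sym (rank≡∣basis∣ F B)))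
      where B = basis V F

    rank-≤-rE : ∀ F → rank V F ≤ rE V
    rank-≤-rE F = subst (_≤ rE V) (sym (rank≡∣basis∣ F B))
      (Independent⇒≤rank (replicate n true) (Basis.G B) (⊆b-replicate (Basis.G B)) (Basis.independent B))
      where B = basis V F

    rE-≤-n : rE V ≤ n
    rE-≤-n = subst (rE V ≤_) (∣supp∣-replicate n) (rank-≤-∣supp∣ (replicate n true))

    card-V : card (mem V) ≡ 2 ^ (n ∸ rE V)
    card-V = trans (sym (card-restrict-replicate V))
                   (trans (card-restrict-rank (replicate n true)) (cong (λ m → 2 ^ (m ∸ rE V)) (∣supp∣-replicate n)))

    dimV≡n∸rE : dimV V ≡ n ∸ rE V
    dimV≡n∸rE = trans (cong ⌊log₂_⌋ (trans (length-filter-allVecs n (mem V)) card-V)) (⌊log₂[2^n]⌋≡n _)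

    rE+dimV≡n : rE V ℕ.+ dimV V ≡ n
    rE+dimV≡n = trans (cong (rE V ℕ.+_) dimV≡n∸rE) (ℕ.m+[n∸m]≡n rE-≤-n)

module TutteEvaluation where

  open Cyclotomic
  open CubeSums
  open BinaryVectors
  open Counting
  open MatroidRank
  open import Algebra.Structures using (IsCommutativeMonoid)
  open import Algebra.Bundles using (CommutativeRing)
  open import Data.Bool using (Bool; true; false; _∧_; if_then_else_)
  open import Data.Nat as ℕ using (ℕ; zero; suc; _≤_; _∸_; _+_)
  import Data.Nat.Properties as ℕ
  open import Data.Vec using (Vec; []; _∷_)
  open import Function using (_∘_)
  open import Relation.Binary.PropositionalEquality

  ⊕ω-isCommutativeMonoid : IsCommutativeMonoid _≡_ _⊕ω_ 0ω
  ⊕ω-isCommutativeMonoid = CommutativeRing.+-isCommutativeMonoid ℤω-commutativeRing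

  open CubeSum ⊕ω-isCommutativeMonoid public using () renaming
    (∑ to ∑ω; ∑-cong to ∑ω-cong; ∑-ε to ∑ω-0ω; ∑-swap to ∑ω-swap; ∑-translate to ∑ω-translate;
     ∑-closed to ∑ω-closed; foldr-allVecs to sumω-allVecs; foldr-filter-allVecs to sumω-filter-allVecs)
  open CubeSumMap ⊕ω-isCommutativeMonoid ⊕ω-isCommutativeMonoid using () renaming (∑-map to ∑ω-map)
  open CubeSumMap ℕ.+-0-isCommutativeMonoid ⊕ω-isCommutativeMonoid using () renaming (∑-map to ∑ℕ-map)

  ⊛-∑ω : ∀ c n (f : Vec Bool n → ℤω) → c ⊛ ∑ω n f ≡ ∑ω n (λ x → c ⊛ f x)
  ⊛-∑ω c = ∑ω-map (c ⊛_) (⊛-distribˡ c)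

  ∑ω-⊛ : ∀ n (f : Vec Bool n → ℤω) c → ∑ω n f ⊛ c ≡ ∑ω n (λ x → f x ⊛ c)
  ∑ω-⊛ n f c = trans (⊛-comm (∑ω n f) c) (trans (⊛-∑ω c n f) (∑ω-cong n (λ x → ⊛-comm c (f x))))

  negω-∑ω : ∀ n (f : Vec Bool n → ℤω) → negω (∑ω n f) ≡ ∑ω n (negω ∘ f)
  negω-∑ω = ∑ω-map negω (λ x y → sym (⁻¹-∙-comm x y))

  conj-∑ω : ∀ n (f : Vec Bool n → ℤω) → conj (∑ω n f) ≡ ∑ω n (conj ∘ f)
  conj-∑ω = ∑ω-map conj conj-⊕ω

  ⌜card⌝ : ∀ {n} (p : Vec Bool n → Bool) → ⌜ card p ⌝ ≡ ∑ω n (λ x → if p x then 1ω else 0ω)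
  ⌜card⌝ {n} p = trans (∑ℕ-map ⌜_⌝ (λ _ _ → refl) n (𝟙 ∘ p)) (∑ω-cong n (⌜𝟙⌝ ∘ p))
    where
    ⌜𝟙⌝ : ∀ b → ⌜ 𝟙 b ⌝ ≡ (if b then 1ω else 0ω)
    ⌜𝟙⌝ true  = refl
    ⌜𝟙⌝ false = refl

  if-⊛ : ∀ b x y → (if b then x else 0ω) ⊛ y ≡ (if b then x ⊛ y else 0ω)
  if-⊛ true  x y = refl
  if-⊛ false x y = zeroˡ y

  if-⊛-comm : ∀ b x c → (if b then x ⊛ c else 0ω) ≡ c ⊛ (if b then x else 0ω)
  if-⊛-comm b x c = trans (sym (if-⊛ b x c)) (⊛-comm (if b then x else 0ω) c)

  ⊛-if : ∀ b x y → x ⊛ (if b then y else 0ω) ≡ (if b then x ⊛ y else 0ω)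
  ⊛-if true  x y = refl
  ⊛-if false x y = zeroʳ x

  ∑ω-supersets : ∀ n (v : Vec Bool n) c →
    ∑ω n (λ F → if v ⊆b F then c ^ω (n ∸ ∣supp∣ F) else 0ω) ≡ (1ω ⊕ω c) ^ω (n ∸ ∣supp∣ v)
  ∑ω-supersets zero    []          c = refl
  ∑ω-supersets (suc n) (true ∷ v)  c =
    trans (cong (_⊕ω S) (∑ω-0ω n)) (trans (⊕ω-identityˡ S) (∑ω-supersets n v c))
    where S = ∑ω n (λ F → if v ⊆b F then c ^ω (n ∸ ∣supp∣ F) else 0ω)
  ∑ω-supersets (suc n) (false ∷ v) c = begin
    ∑ω n (λ F → if v ⊆b F then c ^ω (suc n ∸ ∣supp∣ F) else 0ω) ⊕ω S
      ≡⟨ cong (_⊕ω S) (trans (∑ω-cong n one-more) (sym (⊛-∑ω c n _))) ⟩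
    c ⊛ S ⊕ω S                                ≡⟨ cong (c ⊛ S ⊕ω_) (sym (⊛-identityˡ S)) ⟩
    c ⊛ S ⊕ω 1ω ⊛ S                           ≡⟨ sym (distribʳ S c 1ω) ⟩
    (c ⊕ω 1ω) ⊛ S                             ≡⟨ cong₂ _⊛_ (⊕ω-comm c 1ω) (∑ω-supersets n v c) ⟩
    (1ω ⊕ω c) ⊛ (1ω ⊕ω c) ^ω (n ∸ ∣supp∣ v)   ≡⟨ cong ((1ω ⊕ω c) ^ω_) (sym (ℕ.+-∸-assoc 1 (∣supp∣-≤ v))) ⟩
    (1ω ⊕ω c) ^ω (suc n ∸ ∣supp∣ v)           ∎
    where
    open ≡-Reasoning
    S = ∑ω n (λ F → if v ⊆b F then c ^ω (n ∸ ∣supp∣ F) else 0ω)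
    one-more : ∀ F → (if v ⊆b F then c ^ω (suc n ∸ ∣supp∣ F) else 0ω)
                   ≡ c ⊛ (if v ⊆b F then c ^ω (n ∸ ∣supp∣ F) else 0ω)
    one-more F with v ⊆b F
    ... | true  = cong (c ^ω_) (ℕ.+-∸-assoc 1 (∣supp∣-≤ F))
    ... | false = sym (zeroʳ c)

  m∸n+n∸o≡m∸o : ∀ {m n o} → o ≤ n → n ≤ m → (m ∸ n) + (n ∸ o) ≡ m ∸ o
  m∸n+n∸o≡m∸o {m} {n} {o} o≤n n≤m =
    trans (sym (ℕ.+-∸-assoc (m ∸ n) o≤n)) (cong (_∸ o) (ℕ.m∸n+n≡m n≤m))

  -- x - 1 and y - 1 at (x, y) = (-ι, ι)
  α β : ℤω
  α = negω ι ⊖ω 1ω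
  β = ι ⊖ω 1ω

  β^ω⊛α^ω : ∀ k → β ^ω k ⊛ α ^ω k ≡ ⌜ 2 ℕ.^ k ⌝
  β^ω⊛α^ω k = trans (sym (^ω-distrib-⊛ β α k)) (⌜⌝-^ω 2 k)

  α^ω-cancelˡ : ∀ k x y → α ^ω k ⊛ x ≡ α ^ω k ⊛ y → x ≡ y
  α^ω-cancelˡ k x y eq = ⌜⌝-cancelˡ (2 ℕ.^ k) {{ℕ.m^n≢0 2 k}} x y (trans (sym (β^ω-α^ω x)) (trans (cong (β ^ω k ⊛_) eq) (β^ω-α^ω y)))
    where
    β^ω-α^ω : ∀ z → β ^ω k ⊛ (α ^ω k ⊛ z) ≡ ⌜ 2 ℕ.^ k ⌝ ⊛ z
    β^ω-α^ω z = trans (sym (⊛-assoc (β ^ω k) (α ^ω k) z)) (cong (_⊛ z) (β^ω⊛α^ω k))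

  -ι^[n∸k]≡-ι^n⊛ι^k : ∀ n k → k ≤ n → negω ι ^ω (n ∸ k) ≡ negω ι ^ω n ⊛ ι ^ω k
  -ι^[n∸k]≡-ι^n⊛ι^k n k k≤n = begin
    negω ι ^ω (n ∸ k)                           ≡⟨ sym (*-identityʳ (negω ι ^ω (n ∸ k))) ⟩
    negω ι ^ω (n ∸ k) ⊛ 1ω                      ≡⟨ cong (negω ι ^ω (n ∸ k) ⊛_) (sym (trans (⊛-comm (negω ι ^ω k) (ι ^ω k)) (ι^ω⊛-ι^ω≡1ω k))) ⟩
    negω ι ^ω (n ∸ k) ⊛ (negω ι ^ω k ⊛ ι ^ω k)  ≡⟨ sym (⊛-assoc (negω ι ^ω (n ∸ k)) (negω ι ^ω k) (ι ^ω k)) ⟩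
    negω ι ^ω (n ∸ k) ⊛ negω ι ^ω k ⊛ ι ^ω k    ≡⟨ cong (_⊛ ι ^ω k) (sym (^ω-homo-⊛ (negω ι) (n ∸ k) k)) ⟩
    negω ι ^ω (n ∸ k + k) ⊛ ι ^ω k              ≡⟨ cong (λ m → negω ι ^ω m ⊛ ι ^ω k) (ℕ.m∸n+n≡m k≤n) ⟩
    negω ι ^ω n ⊛ ι ^ω k                        ∎
    where open ≡-Reasoning

  module _ {n : ℕ} (V : Subspace n) where

    gaussSumV : ℤω
    gaussSumV = ∑ω n (λ v → if mem V v then ι ^ω qV V v else 0ω)

    tutte-term : Vec Bool n → ℤω
    tutte-term F = α ^ω (rE V ∸ rank V F) ⊛ β ^ω (∣supp∣ F ∸ rank V F)

    -- both exponents of α add up to n - r(F), and (αβ)^(|F| - r(F)) = 2^(|F| - r(F)) = |V ∩ 2^F|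
    α^dimV⊛tutte-term : ∀ F → α ^ω dimV V ⊛ tutte-term F ≡ α ^ω (n ∸ ∣supp∣ F) ⊛ ⌜ card (mem (restrict V F)) ⌝
    α^dimV⊛tutte-term F = begin
      α ^ω dimV V ⊛ (α ^ω (rE V ∸ r) ⊛ β ^ω k)      ≡⟨ sym (⊛-assoc (α ^ω dimV V) (α ^ω (rE V ∸ r)) (β ^ω k)) ⟩
      α ^ω dimV V ⊛ α ^ω (rE V ∸ r) ⊛ β ^ω k        ≡⟨ cong (_⊛ β ^ω k) (sym (^ω-homo-⊛ α (dimV V) (rE V ∸ r))) ⟩
      α ^ω (dimV V + (rE V ∸ r)) ⊛ β ^ω k           ≡⟨ cong (λ e → α ^ω e ⊛ β ^ω k) exponents ⟩
      α ^ω ((n ∸ ∣supp∣ F) + k) ⊛ β ^ω k            ≡⟨ cong (_⊛ β ^ω k) (^ω-homo-⊛ α (n ∸ ∣supp∣ F) k) ⟩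
      α ^ω (n ∸ ∣supp∣ F) ⊛ α ^ω k ⊛ β ^ω k         ≡⟨ ⊛-assoc (α ^ω (n ∸ ∣supp∣ F)) (α ^ω k) (β ^ω k) ⟩
      α ^ω (n ∸ ∣supp∣ F) ⊛ (α ^ω k ⊛ β ^ω k)       ≡⟨ cong (α ^ω (n ∸ ∣supp∣ F) ⊛_) (trans (⊛-comm (α ^ω k) (β ^ω k)) (β^ω⊛α^ω k)) ⟩
      α ^ω (n ∸ ∣supp∣ F) ⊛ ⌜ 2 ℕ.^ k ⌝              ≡⟨ cong (λ m → α ^ω (n ∸ ∣supp∣ F) ⊛ ⌜ m ⌝) (sym (card-restrict-rank V F)) ⟩
      α ^ω (n ∸ ∣supp∣ F) ⊛ ⌜ card (mem (restrict V F)) ⌝ ∎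
      where
      open ≡-Reasoning
      r = rank V F
      k = ∣supp∣ F ∸ r
      exponents : dimV V + (rE V ∸ r) ≡ (n ∸ ∣supp∣ F) + k
      exponents = begin
        dimV V + (rE V ∸ r)      ≡⟨ cong (_+ (rE V ∸ r)) (dimV≡n∸rE V) ⟩
        (n ∸ rE V) + (rE V ∸ r)  ≡⟨ m∸n+n∸o≡m∸o (rank-≤-rE V F) (rE-≤-n V) ⟩
        n ∸ r                    ≡⟨ sym (m∸n+n∸o≡m∸o (rank-≤-∣supp∣ V F) (∣supp∣-≤ F)) ⟩
        (n ∸ ∣supp∣ F) + k       ∎

    α^[n∸∣F∣]⊛card-restrict : ∀ F → α ^ω (n ∸ ∣supp∣ F) ⊛ ⌜ card (mem (restrict V F)) ⌝
      ≡ ∑ω n (λ v → if mem V v then (if v ⊆b F then α ^ω (n ∸ ∣supp∣ F) else 0ω) else 0ω)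
    α^[n∸∣F∣]⊛card-restrict F =
      trans (cong (α ^ω (n ∸ ∣supp∣ F) ⊛_) (⌜card⌝ (mem (restrict V F))))
            (trans (⊛-∑ω (α ^ω (n ∸ ∣supp∣ F)) n _) (∑ω-cong n pointwise))
      where
      pointwise : ∀ v → α ^ω (n ∸ ∣supp∣ F) ⊛ (if mem V v ∧ v ⊆b F then 1ω else 0ω)
                      ≡ (if mem V v then (if v ⊆b F then α ^ω (n ∸ ∣supp∣ F) else 0ω) else 0ω)
      pointwise v with mem V v | v ⊆b F
      ... | true  | true  = *-identityʳ _
      ... | true  | false = zeroʳ (α ^ω (n ∸ ∣supp∣ F))
      ... | false | _     = zeroʳ (α ^ω (n ∸ ∣supp∣ F))

    ∑ω-supersets-in-V : ∀ v → ∑ω n (λ F → if mem V v then (if v ⊆b F then α ^ω (n ∸ ∣supp∣ F) else 0ω) else 0ω)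
                            ≡ negω ι ^ω n ⊛ (if mem V v then ι ^ω qV V v else 0ω)
    ∑ω-supersets-in-V v with mem V v
    ... | false = trans (∑ω-0ω n) (sym (zeroʳ (negω ι ^ω n)))
    ... | true  = begin
      ∑ω n (λ F → if v ⊆b F then α ^ω (n ∸ ∣supp∣ F) else 0ω) ≡⟨ ∑ω-supersets n v α ⟩
      negω ι ^ω (n ∸ ∣supp∣ v)                                ≡⟨ -ι^[n∸k]≡-ι^n⊛ι^k n (∣supp∣ v) (∣supp∣-≤ v) ⟩
      negω ι ^ω n ⊛ ι ^ω ∣supp∣ v                             ≡⟨ cong (negω ι ^ω n ⊛_) (ι^ω-mod4 (∣supp∣ v)) ⟩
      negω ι ^ω n ⊛ ι ^ω qV V v                               ∎
      where open ≡-Reasoning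

    -- expand |V ∩ 2^F| as a sum over v ∈ V, swap the sums, and apply the binomial theorem
    α^dimV⊛tutte : α ^ω dimV V ⊛ tutte V (negω ι) ι ≡ negω ι ^ω n ⊛ gaussSumV
    α^dimV⊛tutte = begin
      α ^ω dimV V ⊛ tutte V (negω ι) ι
        ≡⟨ cong (α ^ω dimV V ⊛_) (sumω-allVecs n tutte-term) ⟩
      α ^ω dimV V ⊛ ∑ω n tutte-term
        ≡⟨ ⊛-∑ω (α ^ω dimV V) n tutte-term ⟩
      ∑ω n (λ F → α ^ω dimV V ⊛ tutte-term F)
        ≡⟨ ∑ω-cong n (λ F → trans (α^dimV⊛tutte-term F) (α^[n∸∣F∣]⊛card-restrict F)) ⟩
      ∑ω n (λ F → ∑ω n (λ v → if mem V v then (if v ⊆b F then α ^ω (n ∸ ∣supp∣ F) else 0ω) else 0ω))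
        ≡⟨ ∑ω-swap n n _ ⟩
      ∑ω n (λ v → ∑ω n (λ F → if mem V v then (if v ⊆b F then α ^ω (n ∸ ∣supp∣ F) else 0ω) else 0ω))
        ≡⟨ ∑ω-cong n ∑ω-supersets-in-V ⟩
      ∑ω n (λ v → negω ι ^ω n ⊛ (if mem V v then ι ^ω qV V v else 0ω))
        ≡⟨ sym (⊛-∑ω (negω ι ^ω n) n _) ⟩
      negω ι ^ω n ⊛ gaussSumV ∎
      where open ≡-Reasoning

module GaussSums where

  open Cyclotomic
  open BinaryVectors
  open Counting
  open MatroidRank
  open TutteEvaluation
  open import Data.Bool using (Bool; true; false; _∧_; not; _xor_; if_then_else_)
  import Data.Bool.Properties as Bool
  open import Data.Nat as ℕ using (ℕ; zero; suc; _≤_; _<_; _^_; s≤s)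
  import Data.Nat.Properties as ℕ
  open import Data.Nat.DivMod using (_%_; m%n<n)
  open import Data.Nat.Logarithm using (⌊log₂_⌋)
  open import Data.Vec using (Vec)
  open import Data.Product using (∃; _×_; _,_; proj₁; proj₂)
  open import Data.Sum using (inj₁; inj₂)
  open import Data.Empty using (⊥-elim)
  open import Function using (_∘_)
  open import Relation.Nullary using (¬_)
  open import Relation.Binary.PropositionalEquality

  ι^ω-∣supp∣-orthogonal : ∀ {n} (x y : Vec Bool n) → bform x y ≡ false →
    ι ^ω ∣supp∣ x ⊛ ι ^ω ∣supp∣ y ≡ ι ^ω ∣supp∣ (x +v y)
  ι^ω-∣supp∣-orthogonal x y x⊥y =
    trans (sym (^ω-homo-⊛ ι (∣supp∣ x) (∣supp∣ y)))
          (trans (ι^ω-∣supp∣-+v x y) (trans (cong (λ b → ι ^ω ∣supp∣ (x +v y) ⊛ sgn b) x⊥y) (*-identityʳ _)))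

  ∑ω-antisymmetric : ∀ n (f : Vec Bool n → ℤω) c → (∀ x → f (x +v c) ≡ negω (f x)) → ∑ω n f ≡ 0ω
  ∑ω-antisymmetric n f c f-odd =
    x≡negωx⇒x≡0ω _ (trans (sym (∑ω-translate n f c)) (trans (∑ω-cong n f-odd) (sym (negω-∑ω n f))))

  ι^ω-involution : ∀ t → t < 4 → ¬ t ≡ 0 → ι ^ω t ⊛ ι ^ω t ≡ 1ω → ι ^ω t ≡ negω 1ω
  ι^ω-involution 0 _ t≢0 _ = ⊥-elim (t≢0 refl)
  ι^ω-involution 1 _ _   ()
  ι^ω-involution 2 _ _   _ = refl
  ι^ω-involution 3 _ _   ()
  ι^ω-involution (suc (suc (suc (suc _)))) (s≤s (s≤s (s≤s (s≤s ())))) _ _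

  module _ {n : ℕ} (V : Subspace n) where

    q : Vec Bool n → ℕ
    q = qV V

    ι^q-orthogonal : ∀ x y → bform x y ≡ false → ι ^ω q x ⊛ ι ^ω q y ≡ ι ^ω q (x +v y)
    ι^q-orthogonal x y x⊥y =
      trans (sym (cong₂ _⊛_ (ι^ω-mod4 (∣supp∣ x)) (ι^ω-mod4 (∣supp∣ y))))
            (trans (ι^ω-∣supp∣-orthogonal x y x⊥y) (ι^ω-mod4 (∣supp∣ (x +v y))))

    memPerp-elim : ∀ w v → memPerp V w ≡ true → mem V v ≡ true → bform w v ≡ false
    memPerp-elim w v w∈ v∈ = Bool.not-injective (allB-filter-elim n (mem V) _ w∈ v v∈)

    memPerp-intro : ∀ w → (∀ v → mem V v ≡ true → bform w v ≡ false) → memPerp V w ≡ true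
    memPerp-intro w w⊥ = allB-filter-intro n (mem V) _ (λ v v∈ → cong not (w⊥ v v∈))

    memPerp-witness : ∀ w → memPerp V w ≡ false → ∃ λ v → mem V v ≡ true × bform w v ≡ true
    memPerp-witness w w∉ with search n (λ v → mem V v ∧ bform w v)
    ... | inj₁ (v , v∈∧w·v) = v , ∧-true⁻ˡ v∈∧w·v , ∧-true⁻ʳ {mem V v} v∈∧w·v
    ... | inj₂ none = ⊥-elim (true≢false (trans (sym (memPerp-intro w w⊥)) w∉))
      where
      w⊥ : ∀ v → mem V v ≡ true → bform w v ≡ false
      w⊥ v v∈ with bform w v in w·v
      ... | false = refl
      ... | true  = ⊥-elim (true≢false (trans (sym (cong₂ _∧_ v∈ w·v)) (none v)))

    bicycleSpace : Subspace n
    bicycleSpace = record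
      { mem   = memBic V
      ; mem-0 = cong₂ _∧_ (mem-0 V) (memPerp-intro 0v (λ v _ → bform-0v v))
      ; mem-+ = λ x y x∈ y∈ → cong₂ _∧_ (mem-+ V x y (∧-true⁻ˡ x∈) (∧-true⁻ˡ y∈))
          (memPerp-intro (x +v y) λ v v∈ → trans (bform-+v x y v)
            (cong₂ _xor_ (memPerp-elim x v (∧-true⁻ʳ {mem V x} x∈) v∈) (memPerp-elim y v (∧-true⁻ʳ {mem V y} y∈) v∈))) }

    bicycle⇒∈V : ∀ y → memBic V y ≡ true → mem V y ≡ true
    bicycle⇒∈V y = ∧-true⁻ˡ

    ∈V⊥bicycle : ∀ x y → mem V x ≡ true → memBic V y ≡ true → bform x y ≡ false
    ∈V⊥bicycle x y x∈ y∈ = trans (bform-comm x y) (memPerp-elim y x (∧-true⁻ʳ {mem V y} y∈) x∈)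

    card-V≡2^dimV : card (mem V) ≡ 2 ^ dimV V
    card-V≡2^dimV = trans (card-V V) (cong (2 ^_) (sym (dimV≡n∸rE V)))

    card-bicycles : card (memBic V) ≡ 2 ^ d V
    card-bicycles = trans (log₂-card-subspace bicycleSpace)
      (cong (λ m → 2 ^ ⌊log₂ m ⌋) (sym (length-filter-allVecs n (memBic V))))

    d≤dimV : d V ≤ dimV V
    d≤dimV = 2^-cancel-≤ (d V) (dimV V)
      (subst₂ _≤_ card-bicycles card-V≡2^dimV (card-mono n (memBic V) (mem V) bicycle⇒∈V))

    isRep-elim : ∀ x → isRep V x ≡ true → mem V x ≡ true × (∀ y → memBic V y ≡ true → x ≤lex (x +v y) ≡ true)
    isRep-elim x x-rep = ∧-true⁻ˡ x-rep , allB-filter-elim n (memBic V) _ (∧-true⁻ʳ {mem V x} x-rep)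

    isRep-intro : ∀ x → mem V x ≡ true → (∀ y → memBic V y ≡ true → x ≤lex (x +v y) ≡ true) → isRep V x ≡ true
    isRep-intro x x∈ least = cong₂ _∧_ x∈ (allB-filter-intro n (memBic V) _ least)

    -- each coset v + (V ∩ V⊥) of V has exactly one representative, its lexicographic minimum
    card-representatives : ∀ v → card (λ r → isRep V r ∧ memBic V (v +v r)) ≡ 𝟙 (mem V v)
    card-representatives v with mem V v in v∈
    ... | false = trans (∑ℕ-cong n none) (∑ℕ-0 n)
      where
      none : ∀ r → 𝟙 (isRep V r ∧ memBic V (v +v r)) ≡ 0
      none r with isRep V r in r-rep | memBic V (v +v r) in v+r∈
      ... | false | _     = refl
      ... | true  | false = refl
      ... | true  | true  = ⊥-elim (true≢false (trans (sym v∈′) v∈))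
        where v∈′ = trans (cong (mem V) (sym (+v-cancelʳ v r)))
                          (mem-+ V (v +v r) r (bicycle⇒∈V _ v+r∈) (proj₁ (isRep-elim r r-rep)))
    ... | true with ≤lex-minimum n (memBic V ∘ (v +v_)) v (trans (cong (memBic V) (+v-self v)) (mem-0 bicycleSpace))
    ...   | m , v+m∈ , least = trans (∑ℕ-delta n _ m only-m) (cong 𝟙 (cong₂ _∧_ m-rep v+m∈))
      where
      m-rep : isRep V m ≡ true
      m-rep = isRep-intro m (trans (cong (mem V) (sym (+v-cancelˡ v m))) (mem-+ V v (v +v m) v∈ (bicycle⇒∈V _ v+m∈)))
        λ y y∈ → least (m +v y) (subst (λ z → memBic V z ≡ true) (+v-assoc v m y) (mem-+ bicycleSpace (v +v m) y v+m∈ y∈))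
      only-m : ∀ r → ¬ r ≡ m → 𝟙 (isRep V r ∧ memBic V (v +v r)) ≡ 0
      only-m r r≢m with isRep V r in r-rep | memBic V (v +v r) in v+r∈
      ... | false | _     = refl
      ... | true  | false = refl
      ... | true  | true  = ⊥-elim (r≢m (≤lex-antisym r m r≤m (least r v+r∈)))
        where
        r+m∈ : memBic V (r +v m) ≡ true
        r+m∈ = subst (λ z → memBic V z ≡ true) (v+r+v+m≡r+m)
                     (mem-+ bicycleSpace (v +v r) (v +v m) v+r∈ v+m∈)
          where v+r+v+m≡r+m = trans (cong (_+v (v +v m)) (+v-comm v r))
                                    (trans (+v-assoc r v (v +v m)) (cong (r +v_) (+v-cancelˡ v m)))
        r≤m : r ≤lex m ≡ true
        r≤m = subst (λ z → r ≤lex z ≡ true) (+v-cancelˡ r m) (proj₂ (isRep-elim r r-rep) (r +v m) r+m∈)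

    representativeSum bicycleSum : ℤω
    representativeSum = ∑ω n (λ r → if isRep V r then ι ^ω q r else 0ω)
    bicycleSum        = ∑ω n (λ y → if memBic V y then ι ^ω q y else 0ω)

    gaussSum≡representativeSum : gaussSum V ≡ representativeSum
    gaussSum≡representativeSum = sumω-filter-allVecs n (isRep V) (λ x → ι ^ω q x)

    -- V = W ⊕ (V ∩ V⊥) with W the set of representatives, and q is additive on such sums
    gaussSumV≡representativeSum⊛bicycleSum : gaussSumV V ≡ representativeSum ⊛ bicycleSum
    gaussSumV≡representativeSum⊛bicycleSum = sym (begin
      representativeSum ⊛ bicycleSum
        ≡⟨ ∑ω-⊛ n repTerm bicycleSum ⟩
      ∑ω n (λ r → repTerm r ⊛ bicycleSum)
        ≡⟨ ∑ω-cong n (λ r → trans (⊛-∑ω (repTerm r) n bicTerm) (∑ω-cong n (product r))) ⟩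
      ∑ω n (λ r → ∑ω n (λ y → if isRep V r ∧ memBic V y then ι ^ω q (r +v y) else 0ω))
        ≡⟨ ∑ω-cong n (λ r → sym (∑ω-translate n _ r)) ⟩
      ∑ω n (λ r → ∑ω n (λ v → if isRep V r ∧ memBic V (v +v r) then ι ^ω q (r +v (v +v r)) else 0ω))
        ≡⟨ ∑ω-cong n (λ r → ∑ω-cong n (λ v → cancel r v)) ⟩
      ∑ω n (λ r → ∑ω n (λ v → ι ^ω q v ⊛ (if isRep V r ∧ memBic V (v +v r) then 1ω else 0ω)))
        ≡⟨ ∑ω-swap n n _ ⟩
      ∑ω n (λ v → ∑ω n (λ r → ι ^ω q v ⊛ (if isRep V r ∧ memBic V (v +v r) then 1ω else 0ω)))
        ≡⟨ ∑ω-cong n (λ v → sym (⊛-∑ω (ι ^ω q v) n _)) ⟩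
      ∑ω n (λ v → ι ^ω q v ⊛ ∑ω n (λ r → if isRep V r ∧ memBic V (v +v r) then 1ω else 0ω))
        ≡⟨ ∑ω-cong n (λ v → cong (ι ^ω q v ⊛_) (trans (sym (⌜card⌝ (λ r → isRep V r ∧ memBic V (v +v r)))) (cong ⌜_⌝ (card-representatives v)))) ⟩
      ∑ω n (λ v → ι ^ω q v ⊛ ⌜ 𝟙 (mem V v) ⌝)
        ≡⟨ ∑ω-cong n (λ v → ⊛-⌜𝟙⌝ (mem V v) (ι ^ω q v)) ⟩
      gaussSumV V ∎)
      where
      open ≡-Reasoning
      repTerm bicTerm : Vec Bool n → ℤω
      repTerm r = if isRep V r then ι ^ω q r else 0ω
      bicTerm y = if memBic V y then ι ^ω q y else 0ω
      product : ∀ r y → repTerm r ⊛ bicTerm y ≡ (if isRep V r ∧ memBic V y then ι ^ω q (r +v y) else 0ω)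
      product r y with isRep V r in r-rep | memBic V y in y∈
      ... | true  | true  = ι^q-orthogonal r y (∈V⊥bicycle r y (proj₁ (isRep-elim r r-rep)) y∈)
      ... | true  | false = zeroʳ (ι ^ω q r)
      ... | false | _     = zeroˡ (bicTerm y)
      cancel : ∀ r v → (if isRep V r ∧ memBic V (v +v r) then ι ^ω q (r +v (v +v r)) else 0ω)
                     ≡ ι ^ω q v ⊛ (if isRep V r ∧ memBic V (v +v r) then 1ω else 0ω)
      cancel r v rewrite +v-comm v r | +v-cancelˡ r v with isRep V r ∧ memBic V (r +v v)
      ... | true  = sym (*-identityʳ (ι ^ω q v))
      ... | false = sym (zeroʳ (ι ^ω q v))
      ⊛-⌜𝟙⌝ : ∀ b x → x ⊛ ⌜ 𝟙 b ⌝ ≡ (if b then x else 0ω)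
      ⊛-⌜𝟙⌝ true  x = *-identityʳ x
      ⊛-⌜𝟙⌝ false x = zeroʳ x

    bicycleSum-vanishing : qVanishes V → bicycleSum ≡ ⌜ 2 ^ d V ⌝
    bicycleSum-vanishing q≡0 = begin
      bicycleSum                                       ≡⟨ ∑ω-cong n one ⟩
      ∑ω n (λ y → if memBic V y then 1ω else 0ω)       ≡⟨ sym (⌜card⌝ (memBic V)) ⟩
      ⌜ card (memBic V) ⌝                              ≡⟨ cong ⌜_⌝ card-bicycles ⟩
      ⌜ 2 ^ d V ⌝                                      ∎
      where
      open ≡-Reasoning
      one : ∀ y → (if memBic V y then ι ^ω q y else 0ω) ≡ (if memBic V y then 1ω else 0ω)
      one y with memBic V y in y∈
      ... | true  = cong (ι ^ω_) (q≡0 y y∈)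
      ... | false = refl

    -- q is additive on the bicycle space, so ι^q is a character of it; a nontrivial one sums to 0
    bicycleSum-nonvanishing : ¬ qVanishes V → bicycleSum ≡ 0ω
    bicycleSum-nonvanishing q≢0 with search n (λ y → memBic V y ∧ not (q y ℕ.≡ᵇ 0))
    ... | inj₂ none = ⊥-elim (q≢0 q≡0)
      where
      q≡0 : qVanishes V
      q≡0 y y∈ with q y in qy
      ... | zero  = refl
      ... | suc _ = ⊥-elim (true≢false (trans (sym (cong₂ _∧_ y∈ (cong (not ∘ (ℕ._≡ᵇ 0)) qy))) (none y)))
    ... | inj₁ (y₀ , y₀∈∧qy₀≢0) = ∑ω-antisymmetric n bicTerm y₀ flip
      where
      y₀∈ = ∧-true⁻ˡ y₀∈∧qy₀≢0
      qy₀≢0 : ¬ q y₀ ≡ 0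
      qy₀≢0 qy₀≡0 = true≢false (trans (sym (∧-true⁻ʳ {memBic V y₀} y₀∈∧qy₀≢0)) (cong (not ∘ (ℕ._≡ᵇ 0)) qy₀≡0))
      ι^qy₀≡-1 : ι ^ω q y₀ ≡ negω 1ω
      ι^qy₀≡-1 = ι^ω-involution (q y₀) (m%n<n (∣supp∣ y₀) 4) qy₀≢0
        (trans (ι^q-orthogonal y₀ y₀ (∈V⊥bicycle y₀ y₀ (bicycle⇒∈V y₀ y₀∈) y₀∈))
               (cong (ι ^ω_) (trans (cong (λ x → ∣supp∣ x % 4) (+v-self y₀)) (cong (_% 4) (∣supp∣-0v n)))))
      bicTerm : Vec Bool n → ℤω
      bicTerm y = if memBic V y then ι ^ω q y else 0ω
      flip : ∀ y → bicTerm (y +v y₀) ≡ negω (bicTerm y)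
      flip y rewrite mem-+v-cancel bicycleSpace y y₀ y₀∈ with memBic V y in y∈
      ... | false = refl
      ... | true  = begin
        ι ^ω q (y +v y₀)          ≡⟨ sym (ι^q-orthogonal y y₀ (∈V⊥bicycle y y₀ (bicycle⇒∈V y y∈) y₀∈)) ⟩
        ι ^ω q y ⊛ ι ^ω q y₀      ≡⟨ cong (ι ^ω q y ⊛_) ι^qy₀≡-1 ⟩
        ι ^ω q y ⊛ negω 1ω        ≡⟨ sym (-‿distribʳ-* (ι ^ω q y) 1ω) ⟩
        negω (ι ^ω q y ⊛ 1ω)      ≡⟨ cong negω (*-identityʳ (ι ^ω q y)) ⟩
        negω (ι ^ω q y)           ∎
        where open ≡-Reasoning

    ∑-sgn-bform : ∀ u → ∑ω n (λ w → if mem V w then sgn (bform u w) else 0ω)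
                      ≡ (if memPerp V u then ⌜ card (mem V) ⌝ else 0ω)
    ∑-sgn-bform u with memPerp V u in u∈
    ... | true  = trans (∑ω-cong n one) (sym (⌜card⌝ (mem V)))
      where
      one : ∀ w → (if mem V w then sgn (bform u w) else 0ω) ≡ (if mem V w then 1ω else 0ω)
      one w with mem V w in w∈
      ... | true  = cong sgn (memPerp-elim u w u∈ w∈)
      ... | false = refl
    ... | false with memPerp-witness u u∈
    ...   | w₀ , w₀∈ , u·w₀ = ∑ω-antisymmetric n _ w₀ flip
      where
      flip : ∀ w → (if mem V (w +v w₀) then sgn (bform u (w +v w₀)) else 0ω)
                 ≡ negω (if mem V w then sgn (bform u w) else 0ω)
      flip w rewrite mem-+v-cancel V w w₀ w₀∈ with mem V w
      ... | false = refl
      ... | true  = trans (cong sgn u·[w+w₀]≡¬u·w) (sgn-not (bform u w))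
        where
        u·[w+w₀]≡¬u·w : bform u (w +v w₀) ≡ not (bform u w)
        u·[w+w₀]≡¬u·w = begin
          bform u (w +v w₀)             ≡⟨ bform-comm u (w +v w₀) ⟩
          bform (w +v w₀) u             ≡⟨ bform-+v w w₀ u ⟩
          bform w u xor bform w₀ u      ≡⟨ cong₂ _xor_ (bform-comm w u) (trans (bform-comm w₀ u) u·w₀) ⟩
          bform u w xor true            ≡⟨ Bool.xor-comm (bform u w) true ⟩
          not (bform u w)               ∎
          where open ≡-Reasoning

    ι^q[u+w]⊛-ι^qw : ∀ u w → ι ^ω q (u +v w) ⊛ negω ι ^ω q w ≡ ι ^ω q u ⊛ sgn (bform u w)
    ι^q[u+w]⊛-ι^qw u w = begin
      ι ^ω q (u +v w) ⊛ negω ι ^ω q w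
        ≡⟨ cong₂ _⊛_ (sym (ι^ω-mod4 (∣supp∣ (u +v w)))) (sym (^ω-mod (negω ι) 4 refl (∣supp∣ w))) ⟩
      X ⊛ Y
        ≡⟨ sym (*-identityʳ (X ⊛ Y)) ⟩
      X ⊛ Y ⊛ 1ω
        ≡⟨ cong (X ⊛ Y ⊛_) (sym (sgn-⊛-sgn b)) ⟩
      X ⊛ Y ⊛ (sgn b ⊛ sgn b)
        ≡⟨ interchange X Y (sgn b) (sgn b) ⟩
      X ⊛ sgn b ⊛ (Y ⊛ sgn b)
        ≡⟨ cong (_⊛ (Y ⊛ sgn b)) (sym (ι^ω-∣supp∣-+v u w)) ⟩
      ι ^ω (∣supp∣ u ℕ.+ ∣supp∣ w) ⊛ (Y ⊛ sgn b)
        ≡⟨ cong (_⊛ (Y ⊛ sgn b)) (^ω-homo-⊛ ι (∣supp∣ u) (∣supp∣ w)) ⟩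
      ι ^ω ∣supp∣ u ⊛ ι ^ω ∣supp∣ w ⊛ (Y ⊛ sgn b)
        ≡⟨ ⊛-assoc (ι ^ω ∣supp∣ u) (ι ^ω ∣supp∣ w) (Y ⊛ sgn b) ⟩
      ι ^ω ∣supp∣ u ⊛ (ι ^ω ∣supp∣ w ⊛ (Y ⊛ sgn b))
        ≡⟨ cong (ι ^ω ∣supp∣ u ⊛_) (sym (⊛-assoc (ι ^ω ∣supp∣ w) Y (sgn b))) ⟩
      ι ^ω ∣supp∣ u ⊛ (ι ^ω ∣supp∣ w ⊛ Y ⊛ sgn b)
        ≡⟨ cong (λ z → ι ^ω ∣supp∣ u ⊛ (z ⊛ sgn b)) (ι^ω⊛-ι^ω≡1ω (∣supp∣ w)) ⟩
      ι ^ω ∣supp∣ u ⊛ (1ω ⊛ sgn b)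
        ≡⟨ cong₂ _⊛_ (ι^ω-mod4 (∣supp∣ u)) (⊛-identityˡ (sgn b)) ⟩
      ι ^ω q u ⊛ sgn b ∎
      where
      open ≡-Reasoning
      X = ι ^ω ∣supp∣ (u +v w)
      Y = negω ι ^ω ∣supp∣ w
      b = bform u w

    gaussTerm : Vec Bool n → ℤω
    gaussTerm v = if mem V v then ι ^ω q v else 0ω

    gaussTerm-+v⊛conj : ∀ u w → gaussTerm (u +v w) ⊛ conj (gaussTerm w)
      ≡ (if mem V u then ι ^ω q u ⊛ (if mem V w then sgn (bform u w) else 0ω) else 0ω)
    gaussTerm-+v⊛conj u w with mem V w in w∈
    ... | false = trans (zeroʳ (gaussTerm (u +v w))) (sym (if-0ω (mem V u)))
      where
      if-0ω : ∀ b → (if b then ι ^ω q u ⊛ 0ω else 0ω) ≡ 0ω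
      if-0ω true  = zeroʳ (ι ^ω q u)
      if-0ω false = refl
    ... | true rewrite mem-+v-cancel V u w w∈ with mem V u
    ...   | true  = trans (cong (ι ^ω q (u +v w) ⊛_) (conj-^ω ι (q w))) (ι^q[u+w]⊛-ι^qw u w)
    ...   | false = zeroˡ (conj (ι ^ω q w))

    ι^q⊛∑-sgn-bform : ∀ u →
      ∑ω n (λ w → if mem V u then ι ^ω q u ⊛ (if mem V w then sgn (bform u w) else 0ω) else 0ω)
        ≡ ⌜ card (mem V) ⌝ ⊛ (if memBic V u then ι ^ω q u else 0ω)
    ι^q⊛∑-sgn-bform u with mem V u
    ... | false = trans (∑ω-0ω n) (sym (zeroʳ ⌜ card (mem V) ⌝))
    ... | true  = begin
      ∑ω n (λ w → ι ^ω q u ⊛ (if mem V w then sgn (bform u w) else 0ω))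
        ≡⟨ sym (⊛-∑ω (ι ^ω q u) n _) ⟩
      ι ^ω q u ⊛ ∑ω n (λ w → if mem V w then sgn (bform u w) else 0ω)
        ≡⟨ cong (ι ^ω q u ⊛_) (∑-sgn-bform u) ⟩
      ι ^ω q u ⊛ (if memPerp V u then ⌜ card (mem V) ⌝ else 0ω)
        ≡⟨ ⊛-if (memPerp V u) (ι ^ω q u) ⌜ card (mem V) ⌝ ⟩
      (if memPerp V u then ι ^ω q u ⊛ ⌜ card (mem V) ⌝ else 0ω)
        ≡⟨ if-⊛-comm (memPerp V u) (ι ^ω q u) ⌜ card (mem V) ⌝ ⟩
      ⌜ card (mem V) ⌝ ⊛ (if memPerp V u then ι ^ω q u else 0ω) ∎
      where open ≡-Reasoning

    -- expand |S|², substitute v = u + w and collect the character sums of ∑-sgn-bform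
    gaussSumV⊛conj : gaussSumV V ⊛ conj (gaussSumV V) ≡ ⌜ card (mem V) ⌝ ⊛ bicycleSum
    gaussSumV⊛conj = begin
      gaussSumV V ⊛ conj (gaussSumV V)
        ≡⟨ cong (gaussSumV V ⊛_) (conj-∑ω n gaussTerm) ⟩
      gaussSumV V ⊛ ∑ω n (conj ∘ gaussTerm)
        ≡⟨ trans (∑ω-⊛ n gaussTerm _) (∑ω-cong n (λ v → ⊛-∑ω (gaussTerm v) n (conj ∘ gaussTerm))) ⟩
      ∑ω n (λ v → ∑ω n (λ w → gaussTerm v ⊛ conj (gaussTerm w)))
        ≡⟨ ∑ω-swap n n _ ⟩
      ∑ω n (λ w → ∑ω n (λ v → gaussTerm v ⊛ conj (gaussTerm w)))
        ≡⟨ ∑ω-cong n (λ w → sym (∑ω-translate n (λ v → gaussTerm v ⊛ conj (gaussTerm w)) w)) ⟩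
      ∑ω n (λ w → ∑ω n (λ u → gaussTerm (u +v w) ⊛ conj (gaussTerm w)))
        ≡⟨ ∑ω-cong n (λ w → ∑ω-cong n (λ u → gaussTerm-+v⊛conj u w)) ⟩
      ∑ω n (λ w → ∑ω n (λ u → if mem V u then ι ^ω q u ⊛ (if mem V w then sgn (bform u w) else 0ω) else 0ω))
        ≡⟨ ∑ω-swap n n _ ⟩
      ∑ω n (λ u → ∑ω n (λ w → if mem V u then ι ^ω q u ⊛ (if mem V w then sgn (bform u w) else 0ω) else 0ω))
        ≡⟨ ∑ω-cong n ι^q⊛∑-sgn-bform ⟩
      ∑ω n (λ u → ⌜ card (mem V) ⌝ ⊛ (if memBic V u then ι ^ω q u else 0ω))
        ≡⟨ sym (⊛-∑ω ⌜ card (mem V) ⌝ n _) ⟩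
      ⌜ card (mem V) ⌝ ⊛ bicycleSum ∎
      where open ≡-Reasoning

module SumsOfTwoSquares where

  open import Data.Nat as ℕ using (ℕ; zero; suc; _+_; _*_; _^_; _≤_; _<_; z≤n; s≤s)
  import Data.Nat.Properties as ℕ
  open import Data.Nat.Tactic.RingSolver using (solve-∀)
  open import Data.Product using (∃; _,_)
  open import Data.Sum using (_⊎_; inj₁; inj₂)
  open import Data.Empty using (⊥; ⊥-elim)
  open import Relation.Binary.PropositionalEquality

  data TwoSquares : ℕ → ℕ → ℕ → Set where
    horizontal : ∀ k → TwoSquares (2 * k) (2 ^ k) 0
    vertical   : ∀ k → TwoSquares (2 * k) 0 (2 ^ k)
    diagonal   : ∀ k → TwoSquares (suc (2 * k)) (2 ^ k) (2 ^ k)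

  2*[1+k]≡2+2*k : ∀ k → 2 * suc k ≡ 2 + 2 * k
  2*[1+k]≡2+2*k = solve-∀

  TwoSquares-double : ∀ {m a b} → TwoSquares m a b → TwoSquares (2 + m) (2 * a) (2 * b)
  TwoSquares-double (horizontal k) = subst (λ m → TwoSquares m (2 ^ suc k) 0) (2*[1+k]≡2+2*k k) (horizontal (suc k))
  TwoSquares-double (vertical k)   = subst (λ m → TwoSquares m 0 (2 ^ suc k)) (2*[1+k]≡2+2*k k) (vertical (suc k))
  TwoSquares-double (diagonal k)   =
    subst (λ m → TwoSquares m (2 ^ suc k) (2 ^ suc k)) (cong suc (2*[1+k]≡2+2*k k)) (diagonal (suc k))

  parity : ∀ a → ∃ λ h → a ≡ 2 * h ⊎ a ≡ suc (2 * h)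
  parity zero    = 0 , inj₁ refl
  parity (suc a) with parity a
  ... | h , inj₁ refl = h , inj₂ refl
  ... | h , inj₂ refl = suc h , inj₁ (sym (ℕ.*-distribˡ-+ 2 1 h))

  ≥2⇒square≥4 : ∀ a → 4 ≤ suc (suc a) * suc (suc a)
  ≥2⇒square≥4 a = ℕ.*-mono-≤ {2} {suc (suc a)} {2} (s≤s (s≤s z≤n)) (s≤s (s≤s z≤n))

  too-big : ∀ x y m → 4 ≤ x → x + y ≡ 2 ^ m → 2 ^ m < 4 → ⊥
  too-big x y m 4≤x eq = ℕ.≤⇒≯ (ℕ.≤-trans 4≤x (ℕ.≤-trans (ℕ.m≤m+n x y) (ℕ.≤-reflexive eq)))

  even-even : ∀ h g → 2 * h * (2 * h) + 2 * g * (2 * g) ≡ 2 * (2 * (h * h + g * g))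
  even-even = solve-∀

  odd-even : ∀ h g → suc (2 * h) * suc (2 * h) + 2 * g * (2 * g) ≡ suc (2 * (2 * (h * h + h + g * g)))
  odd-even = solve-∀

  even-odd : ∀ h g → 2 * h * (2 * h) + suc (2 * g) * suc (2 * g) ≡ suc (2 * (2 * (h * h + g * g + g)))
  even-odd = solve-∀

  odd-odd : ∀ h g → suc (2 * h) * suc (2 * h) + suc (2 * g) * suc (2 * g) ≡ 2 * suc (2 * (h * h + h + g * g + g))
  odd-odd = solve-∀

  -- both squares must be even once 4 ∣ 2ᵐ, and halving them reduces m by 2
  twoSquares : ∀ m a b → a * a + b * b ≡ 2 ^ m → TwoSquares m a b
  twoSquares 0 0 1 _ = vertical 0
  twoSquares 0 1 0 _ = horizontal 0
  twoSquares 1 1 1 _ = diagonal 0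
  twoSquares 0 0 0 ()
  twoSquares 0 1 1 ()
  twoSquares 1 0 0 ()
  twoSquares 1 0 1 ()
  twoSquares 1 1 0 ()
  twoSquares 0 (suc (suc a)) b eq = ⊥-elim (too-big _ (b * b) 0 (≥2⇒square≥4 a) eq (s≤s (s≤s z≤n)))
  twoSquares 1 (suc (suc a)) b eq = ⊥-elim (too-big _ (b * b) 1 (≥2⇒square≥4 a) eq (s≤s (s≤s (s≤s z≤n))))
  twoSquares 0 a (suc (suc b)) eq = ⊥-elim (too-big _ (a * a) 0 (≥2⇒square≥4 b) (trans (ℕ.+-comm _ (a * a)) eq) (s≤s (s≤s z≤n)))
  twoSquares 1 a (suc (suc b)) eq = ⊥-elim (too-big _ (a * a) 1 (≥2⇒square≥4 b) (trans (ℕ.+-comm _ (a * a)) eq) (s≤s (s≤s (s≤s z≤n))))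
  twoSquares (suc (suc m)) a b eq with parity a | parity b
  ... | h , inj₁ refl | g , inj₁ refl = TwoSquares-double (twoSquares m h g (½ (½ (trans (sym (even-even h g)) eq))))
    where
    ½ : ∀ {x y} → 2 * x ≡ 2 * y → x ≡ y
    ½ {x} {y} = ℕ.*-cancelˡ-≡ x y 2
  ... | h , inj₂ refl | g , inj₁ refl = ⊥-elim (ℕ.even≢odd (2 * 2 ^ m) (2 * (h * h + h + g * g)) (sym (trans (sym (odd-even h g)) eq)))
  ... | h , inj₁ refl | g , inj₂ refl = ⊥-elim (ℕ.even≢odd (2 * 2 ^ m) (2 * (h * h + g * g + g)) (sym (trans (sym (even-odd h g)) eq)))
  ... | h , inj₂ refl | g , inj₂ refl = ⊥-elim (ℕ.even≢odd (2 ^ m) (h * h + h + g * g + g) (sym (ℕ.*-cancelˡ-≡ _ _ 2 (trans (sym (odd-odd h g)) eq))))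

module GaussianIntegers where

  open Cyclotomic
  open SumsOfTwoSquares
  open import Data.Nat as ℕ using (ℕ; zero; suc)
  import Data.Nat.Properties as ℕ
  open import Data.Integer as ℤ using (ℤ; +_; -_; -[1+_]; _+_; _-_; _*_; ∣_∣)
  import Data.Integer.Properties as ℤ
  open import Data.Integer.Tactic.RingSolver using (solve-∀)
  open import Data.Fin using (Fin; toℕ; #_)
  open import Data.Product using (∃; _×_; _,_)
  open import Data.Sum using (_⊎_; inj₁; inj₂)
  open import Relation.Binary.PropositionalEquality

  IsGaussian : ℤω → Set
  IsGaussian z = c₁ z ≡ + 0 × c₃ z ≡ + 0

  ⊕ω-gaussian : ∀ {x y} → IsGaussian x → IsGaussian y → IsGaussian (x ⊕ω y)
  ⊕ω-gaussian (x₁≡0 , x₃≡0) (y₁≡0 , y₃≡0) = cong₂ _+_ x₁≡0 y₁≡0 , cong₂ _+_ x₃≡0 y₃≡0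

  ι^ω-gaussian : ∀ k → IsGaussian (ι ^ω k)
  ι^ω-gaussian zero    = refl , refl
  ι^ω-gaussian (suc k) with ι ^ω k | ι^ω-gaussian k
  ... | ⟨ a , _ , c , _ ⟩ | refl , refl = e₁ a c , e₃ a c
    where
    e₁ : ∀ a c → + 0 * + 0 + + 0 * a - (+ 1 * + 0 + + 0 * c) ≡ + 0
    e₁ = solve-∀
    e₃ : ∀ a c → + 0 * + 0 + + 0 * c + + 1 * + 0 + + 0 * a ≡ + 0
    e₃ = solve-∀

  norm-gaussian : ∀ x y → c₀ (⟨ x , + 0 , y , + 0 ⟩ ⊛ conj ⟨ x , + 0 , y , + 0 ⟩) ≡ x * x + y * y
  norm-gaussian = solve-∀′
    where
    solve-∀′ : ∀ x y → x * x - (+ 0 * - + 0 + y * - y + + 0 * - + 0) ≡ x * x + y * y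
    solve-∀′ = solve-∀

  √2^ω-double : ∀ k → √2 ^ω (2 ℕ.* k) ≡ ⌜ 2 ℕ.^ k ⌝
  √2^ω-double k = begin
    √2 ^ω (2 ℕ.* k)     ≡⟨ cong (√2 ^ω_) (ℕ.*-comm 2 k) ⟩
    √2 ^ω (k ℕ.* 2)     ≡⟨ sym (^ω-assocʳ √2 2 k) ⟩
    ⌜ 2 ⌝ ^ω k          ≡⟨ ⌜⌝-^ω 2 k ⟩
    ⌜ 2 ℕ.^ k ⌝         ∎
    where open ≡-Reasoning

  scaled-unit : ∀ k e (σ : Fin 8) x y → ⟨ x , + 0 , y , + 0 ⟩ ≡ √2 ^ω e ⊛ expπι/4 (+ toℕ σ) →
    ⟨ + (2 ℕ.^ k) * x , + 0 , + (2 ℕ.^ k) * y , + 0 ⟩ ≡ √2 ^ω (e ℕ.+ 2 ℕ.* k) ⊛ expπι/4 (+ toℕ σ)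
  scaled-unit k e σ x y unit = begin
    ⟨ + (2 ℕ.^ k) * x , + 0 , + (2 ℕ.^ k) * y , + 0 ⟩
      ≡⟨ ⟨⟩-cong refl (sym (ℤ.*-zeroʳ (+ (2 ℕ.^ k)))) refl (sym (ℤ.*-zeroʳ (+ (2 ℕ.^ k)))) ⟩
    ⟨ + (2 ℕ.^ k) * x , + (2 ℕ.^ k) * + 0 , + (2 ℕ.^ k) * y , + (2 ℕ.^ k) * + 0 ⟩
      ≡⟨ sym (⌜⌝-⊛ (2 ℕ.^ k) ⟨ x , + 0 , y , + 0 ⟩) ⟩
    ⌜ 2 ℕ.^ k ⌝ ⊛ ⟨ x , + 0 , y , + 0 ⟩
      ≡⟨ cong₂ _⊛_ (sym (√2^ω-double k)) unit ⟩
    √2 ^ω (2 ℕ.* k) ⊛ (√2 ^ω e ⊛ E)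
      ≡⟨ sym (⊛-assoc (√2 ^ω (2 ℕ.* k)) (√2 ^ω e) E) ⟩
    √2 ^ω (2 ℕ.* k) ⊛ √2 ^ω e ⊛ E
      ≡⟨ cong (_⊛ E) (sym (^ω-homo-⊛ √2 (2 ℕ.* k) e)) ⟩
    √2 ^ω (2 ℕ.* k ℕ.+ e) ⊛ E
      ≡⟨ cong (λ m → √2 ^ω m ⊛ E) (ℕ.+-comm (2 ℕ.* k) e) ⟩
    √2 ^ω (e ℕ.+ 2 ℕ.* k) ⊛ E ∎
    where
    open ≡-Reasoning
    E = expπι/4 (+ toℕ σ)

  ∣i∣≡n⇒i≡n*±1 : ∀ x {P} → ∣ x ∣ ≡ P → x ≡ + P * + 1 ⊎ x ≡ + P * -[1+ 0 ]
  ∣i∣≡n⇒i≡n*±1 (+ a)    refl = inj₁ (sym (ℤ.*-identityʳ (+ a)))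
  ∣i∣≡n⇒i≡n*±1 -[1+ a ] refl = inj₂ (sym (trans (ℤ.*-comm (+ suc a) -[1+ 0 ]) (ℤ.-1*i≡-i (+ suc a))))

  ∣i∣≡0⇒i≡n*0 : ∀ x P → ∣ x ∣ ≡ 0 → x ≡ + P * + 0
  ∣i∣≡0⇒i≡n*0 (+ 0) P _ = sym (ℤ.*-zeroʳ (+ P))

  unit-multiple : ∀ {m a b} → TwoSquares m a b → ∀ x y → ∣ x ∣ ≡ a → ∣ y ∣ ≡ b →
    ∃ λ (σ : Fin 8) → ⟨ x , + 0 , y , + 0 ⟩ ≡ √2 ^ω m ⊛ expπι/4 (+ toℕ σ)
  unit-multiple (horizontal k) x y ∣x∣ ∣y∣ with ∣i∣≡n⇒i≡n*±1 x ∣x∣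
  ... | inj₁ x≡ = # 0 , trans (⟨⟩-cong x≡ refl (∣i∣≡0⇒i≡n*0 y (2 ℕ.^ k) ∣y∣) refl) (scaled-unit k 0 (# 0) (+ 1) (+ 0) refl)
  ... | inj₂ x≡ = # 4 , trans (⟨⟩-cong x≡ refl (∣i∣≡0⇒i≡n*0 y (2 ℕ.^ k) ∣y∣) refl) (scaled-unit k 0 (# 4) -[1+ 0 ] (+ 0) refl)
  unit-multiple (vertical k) x y ∣x∣ ∣y∣ with ∣i∣≡n⇒i≡n*±1 y ∣y∣
  ... | inj₁ y≡ = # 2 , trans (⟨⟩-cong (∣i∣≡0⇒i≡n*0 x (2 ℕ.^ k) ∣x∣) refl y≡ refl) (scaled-unit k 0 (# 2) (+ 0) (+ 1) refl)
  ... | inj₂ y≡ = # 6 , trans (⟨⟩-cong (∣i∣≡0⇒i≡n*0 x (2 ℕ.^ k) ∣x∣) refl y≡ refl) (scaled-unit k 0 (# 6) (+ 0) -[1+ 0 ] refl)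
  unit-multiple (diagonal k) x y ∣x∣ ∣y∣ with ∣i∣≡n⇒i≡n*±1 x ∣x∣ | ∣i∣≡n⇒i≡n*±1 y ∣y∣
  ... | inj₁ x≡ | inj₁ y≡ = # 1 , trans (⟨⟩-cong x≡ refl y≡ refl) (scaled-unit k 1 (# 1) (+ 1) (+ 1) refl)
  ... | inj₂ x≡ | inj₁ y≡ = # 3 , trans (⟨⟩-cong x≡ refl y≡ refl) (scaled-unit k 1 (# 3) -[1+ 0 ] (+ 1) refl)
  ... | inj₂ x≡ | inj₂ y≡ = # 5 , trans (⟨⟩-cong x≡ refl y≡ refl) (scaled-unit k 1 (# 5) -[1+ 0 ] -[1+ 0 ] refl)
  ... | inj₁ x≡ | inj₂ y≡ = # 7 , trans (⟨⟩-cong x≡ refl y≡ refl) (scaled-unit k 1 (# 7) (+ 1) -[1+ 0 ] refl)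

  norm-2^m⇒√2^m⊛ω^σ : ∀ x y m → x * x + y * y ≡ + (2 ℕ.^ m) →
    ∃ λ (σ : Fin 8) → ⟨ x , + 0 , y , + 0 ⟩ ≡ √2 ^ω m ⊛ expπι/4 (+ toℕ σ)
  norm-2^m⇒√2^m⊛ω^σ x y m eq = unit-multiple (twoSquares m ∣ x ∣ ∣ y ∣ ∣x∣²+∣y∣²≡2^m) x y refl refl
    where
    square : ∀ z → z * z ≡ + (∣ z ∣ ℕ.* ∣ z ∣)
    square (+ a)    = ℤ.+◃n≡+n (a ℕ.* a)
    square -[1+ a ] = ℤ.+◃n≡+n (suc a ℕ.* suc a)
    ∣x∣²+∣y∣²≡2^m : ∣ x ∣ ℕ.* ∣ x ∣ ℕ.+ ∣ y ∣ ℕ.* ∣ y ∣ ≡ 2 ℕ.^ m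
    ∣x∣²+∣y∣²≡2^m = ℤ.+-injective (trans (ℤ.pos-+ (∣ x ∣ ℕ.* ∣ x ∣) _) (trans (sym (cong₂ _+_ (square x) (square y))) eq))

open Cyclotomic
open Counting
open MatroidRank
open TutteEvaluation
open GaussSums
open GaussianIntegers
open import Data.Bool using (true; false; if_then_else_)
open import Data.Nat as ℕ using (ℕ)
import Data.Nat.Properties as ℕ
import Data.Nat.Tactic.RingSolver as ℕ-Solver
open import Data.Integer as ℤ using (+_; _+_; _-_; _*_)
import Data.Integer.Properties as ℤ
open import Data.Integer.Tactic.RingSolver using (solve-∀)
open import Data.Fin using (Fin; toℕ)
open import Data.Product using (Σ; ∃; _×_; _,_; proj₁; proj₂)
open import Relation.Nullary using (¬_)
open import Relation.Binary.PropositionalEquality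

module _ {n : ℕ} (V : Subspace n) where

  private
    G H : ℤω
    G = representativeSum V
    H = bicycleSum V

  representativeSum-gaussian : IsGaussian G
  representativeSum-gaussian = ∑ω-closed IsGaussian (λ {x} {y} → ⊕ω-gaussian {x} {y}) n (λ r → if isRep V r then ι ^ω qV V r else 0ω) gaussian
    where
    gaussian : ∀ r → IsGaussian (if isRep V r then ι ^ω qV V r else 0ω)
    gaussian r with isRep V r
    ... | true  = ι^ω-gaussian (qV V r)
    ... | false = refl , refl

  -- |G H|² = |V| H with H = 2^d real, |V| = 2^(dim W + d)
  representativeSum-norm : qVanishes V → G ⊛ conj G ≡ ⌜ 2 ℕ.^ dimW V ⌝
  representativeSum-norm q≡0 = cancel (cancel (begin
    D ⊛ (D ⊛ (G ⊛ conj G))                 ≡⟨ sym (⊛-assoc D D (G ⊛ conj G)) ⟩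
    D ⊛ D ⊛ (G ⊛ conj G)                   ≡⟨ ⊛-comm (D ⊛ D) (G ⊛ conj G) ⟩
    G ⊛ conj G ⊛ (D ⊛ D)                   ≡⟨ interchange G (conj G) D D ⟩
    G ⊛ D ⊛ (conj G ⊛ D)                   ≡⟨ cong (λ h → G ⊛ h ⊛ (conj G ⊛ conj h)) (sym H≡D) ⟩
    G ⊛ H ⊛ (conj G ⊛ conj H)              ≡⟨ cong (G ⊛ H ⊛_) (sym (conj-⊛ G H)) ⟩
    G ⊛ H ⊛ conj (G ⊛ H)                   ≡⟨ cong (λ s → s ⊛ conj s) (sym (gaussSumV≡representativeSum⊛bicycleSum V)) ⟩
    gaussSumV V ⊛ conj (gaussSumV V)       ≡⟨ gaussSumV⊛conj V ⟩
    ⌜ card (mem V) ⌝ ⊛ H                   ≡⟨ cong₂ _⊛_ (cong ⌜_⌝ (card-V≡2^dimV V)) H≡D ⟩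
    ⌜ 2 ℕ.^ dimV V ⌝ ⊛ D                   ≡⟨ cong (_⊛ D) (trans (cong (λ m → ⌜ 2 ℕ.^ m ⌝) (sym dimW+d≡dimV))
                                                    (trans (cong ⌜_⌝ (ℕ.^-distribˡ-+-* 2 (dimW V) (d V))) (⌜⌝-* (2 ℕ.^ dimW V) (2 ℕ.^ d V)))) ⟩
    ⌜ 2 ℕ.^ dimW V ⌝ ⊛ D ⊛ D               ≡⟨ ⊛-comm (⌜ 2 ℕ.^ dimW V ⌝ ⊛ D) D ⟩
    D ⊛ (⌜ 2 ℕ.^ dimW V ⌝ ⊛ D)             ≡⟨ cong (D ⊛_) (⊛-comm ⌜ 2 ℕ.^ dimW V ⌝ D) ⟩
    D ⊛ (D ⊛ ⌜ 2 ℕ.^ dimW V ⌝)             ∎))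
    where
    open ≡-Reasoning
    D = ⌜ 2 ℕ.^ d V ⌝
    H≡D = bicycleSum-vanishing V q≡0
    dimW+d≡dimV : dimW V ℕ.+ d V ≡ dimV V
    dimW+d≡dimV = ℕ.m∸n+n≡m (d≤dimV V)
    cancel : ∀ {x y} → D ⊛ x ≡ D ⊛ y → x ≡ y
    cancel = ⌜⌝-cancelˡ (2 ℕ.^ d V) {{ℕ.m^n≢0 2 (d V)}} _ _

  representativeSum≡⟨c₀,0,c₂,0⟩ : G ≡ ⟨ c₀ G , + 0 , c₂ G , + 0 ⟩
  representativeSum≡⟨c₀,0,c₂,0⟩ =
    ⟨⟩-cong refl (proj₁ representativeSum-gaussian) refl (proj₂ representativeSum-gaussian)

  brown-invariant : qVanishes V → ∃ λ σ → IsBrownInvariant V σ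
  brown-invariant q≡0 = proj₁ G≡√2^m⊛ω^σ ,
    trans (gaussSum≡representativeSum V) (trans representativeSum≡⟨c₀,0,c₂,0⟩ (proj₂ G≡√2^m⊛ω^σ))
    where
    norm : c₀ G * c₀ G + c₂ G * c₂ G ≡ + (2 ℕ.^ dimW V)
    norm = trans (sym (norm-gaussian (c₀ G) (c₂ G)))
      (cong c₀ (trans (cong (λ z → z ⊛ conj z) (sym representativeSum≡⟨c₀,0,c₂,0⟩)) (representativeSum-norm q≡0)))
    G≡√2^m⊛ω^σ = norm-2^m⇒√2^m⊛ω^σ (c₀ G) (c₂ G) (dimW V) norm

ω^⊛√2^ : ∀ a b c e → ω ^ω a ⊛ √2 ^ω b ⊛ (ω ^ω c ⊛ √2 ^ω e) ≡ ω ^ω (a ℕ.+ c) ⊛ √2 ^ω (b ℕ.+ e)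
ω^⊛√2^ a b c e = trans (interchange (ω ^ω a) (√2 ^ω b) (ω ^ω c) (√2 ^ω e))
                       (sym (cong₂ _⊛_ (^ω-homo-⊛ ω a c) (^ω-homo-⊛ √2 b e)))

-- -ι = ω⁶
-ι^n⊛√2^dW⊛ω^s⊛2^d : ∀ s n dV dW d → dW ℕ.+ d ≡ dV →
  negω ι ^ω n ⊛ (√2 ^ω dW ⊛ expπι/4 (+ s) ⊛ ⌜ 2 ℕ.^ d ⌝) ≡ ω ^ω (s ℕ.+ n ℕ.* 6) ⊛ √2 ^ω (dV ℕ.+ d)
-ι^n⊛√2^dW⊛ω^s⊛2^d s n dV dW d dW+d≡dV = begin
  negω ι ^ω n ⊛ (√2 ^ω dW ⊛ expπι/4 (+ s) ⊛ ⌜ 2 ℕ.^ d ⌝)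
    ≡⟨ cong₂ _⊛_ (^ω-assocʳ ω 6 n) (cong₂ _⊛_ (cong (√2 ^ω dW ⊛_) (expπι/4-≡ω^ω (+ s) s 0 (ℤ.+-identityʳ (+ s))))
                                              (sym (√2^ω-double d))) ⟩
  ω ^ω (n ℕ.* 6) ⊛ (√2 ^ω dW ⊛ ω ^ω s ⊛ √2 ^ω (2 ℕ.* d))
    ≡⟨ cong (ω ^ω (n ℕ.* 6) ⊛_) (trans (cong (_⊛ √2 ^ω (2 ℕ.* d)) (⊛-comm (√2 ^ω dW) (ω ^ω s)))
                                        (⊛-assoc (ω ^ω s) (√2 ^ω dW) (√2 ^ω (2 ℕ.* d)))) ⟩
  ω ^ω (n ℕ.* 6) ⊛ (ω ^ω s ⊛ (√2 ^ω dW ⊛ √2 ^ω (2 ℕ.* d)))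
    ≡⟨ sym (⊛-assoc (ω ^ω (n ℕ.* 6)) (ω ^ω s) (√2 ^ω dW ⊛ √2 ^ω (2 ℕ.* d))) ⟩
  ω ^ω (n ℕ.* 6) ⊛ ω ^ω s ⊛ (√2 ^ω dW ⊛ √2 ^ω (2 ℕ.* d))
    ≡⟨ sym (cong₂ _⊛_ (^ω-homo-⊛ ω (n ℕ.* 6) s) (^ω-homo-⊛ √2 dW (2 ℕ.* d))) ⟩
  ω ^ω (n ℕ.* 6 ℕ.+ s) ⊛ √2 ^ω (dW ℕ.+ 2 ℕ.* d)
    ≡⟨ cong₂ (λ a b → ω ^ω a ⊛ √2 ^ω b) (ℕ.+-comm (n ℕ.* 6) s)
             (trans (dW+2d≡dW+d+d dW d) (cong (ℕ._+ d) dW+d≡dV)) ⟩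
  ω ^ω (s ℕ.+ n ℕ.* 6) ⊛ √2 ^ω (dV ℕ.+ d) ∎
  where
  open ≡-Reasoning
  dW+2d≡dW+d+d : ∀ dW d → dW ℕ.+ 2 ℕ.* d ≡ dW ℕ.+ d ℕ.+ d
  dW+2d≡dW+d+d = ℕ-Solver.solve-∀

-- α = ω⁵ √2, and s + n - 3r ≡ s + n + 5r (mod 8)
α^dV⊛ω^[s+n-3r]⊛√2^d : ∀ s n r dV d → r ℕ.+ dV ≡ n →
  α ^ω dV ⊛ (expπι/4 (+ s + + n - + 3 * + r) ⊛ √2 ^ω d) ≡ ω ^ω (s ℕ.+ n ℕ.* 6) ⊛ √2 ^ω (dV ℕ.+ d)
α^dV⊛ω^[s+n-3r]⊛√2^d s n r dV d r+dV≡n = begin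
  α ^ω dV ⊛ (expπι/4 (+ s + + n - + 3 * + r) ⊛ √2 ^ω d)
    ≡⟨ cong₂ _⊛_ (trans (^ω-distrib-⊛ (ω ^ω 5) √2 dV) (cong (_⊛ √2 ^ω dV) (^ω-assocʳ ω 5 dV)))
                 (cong (_⊛ √2 ^ω d) (expπι/4-≡ω^ω (+ s + + n - + 3 * + r) (s ℕ.+ n ℕ.+ r ℕ.* 5) r exponent)) ⟩
  ω ^ω (dV ℕ.* 5) ⊛ √2 ^ω dV ⊛ (ω ^ω (s ℕ.+ n ℕ.+ r ℕ.* 5) ⊛ √2 ^ω d)
    ≡⟨ ω^⊛√2^ (dV ℕ.* 5) dV (s ℕ.+ n ℕ.+ r ℕ.* 5) d ⟩
  ω ^ω (dV ℕ.* 5 ℕ.+ (s ℕ.+ n ℕ.+ r ℕ.* 5)) ⊛ √2 ^ω (dV ℕ.+ d)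
    ≡⟨ cong (λ a → ω ^ω a ⊛ √2 ^ω (dV ℕ.+ d)) (trans (cong (λ m → dV ℕ.* 5 ℕ.+ (s ℕ.+ m ℕ.+ r ℕ.* 5)) (sym r+dV≡n))
                                                     (trans (five-plus-one s r dV) (cong (λ m → s ℕ.+ m ℕ.* 6) r+dV≡n))) ⟩
  ω ^ω (s ℕ.+ n ℕ.* 6) ⊛ √2 ^ω (dV ℕ.+ d) ∎
  where
  open ≡-Reasoning
  five-plus-one : ∀ s r dV → dV ℕ.* 5 ℕ.+ (s ℕ.+ (r ℕ.+ dV) ℕ.+ r ℕ.* 5) ≡ s ℕ.+ (r ℕ.+ dV) ℕ.* 6
  five-plus-one = ℕ-Solver.solve-∀
  solved : ∀ s n r → s + n - + 3 * r + r * + 8 ≡ s + n + r * + 5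
  solved = solve-∀
  exponent : + s + + n - + 3 * + r + + (r ℕ.* 8) ≡ + (s ℕ.+ n ℕ.+ r ℕ.* 5)
  exponent = begin
    + s + + n - + 3 * + r + + (r ℕ.* 8)  ≡⟨ cong (_+_ (+ s + + n - + 3 * + r)) (ℤ.pos-* r 8) ⟩
    + s + + n - + 3 * + r + + r * + 8    ≡⟨ solved (+ s) (+ n) (+ r) ⟩
    + s + + n + + r * + 5                ≡⟨ sym (trans (ℤ.pos-+ (s ℕ.+ n) (r ℕ.* 5)) (cong₂ _+_ (ℤ.pos-+ s n) (ℤ.pos-* r 5))) ⟩
    + (s ℕ.+ n ℕ.+ r ℕ.* 5)              ∎

module _ {n : ℕ} (V : Subspace n) where

  private
    T = tutte V (negω ι) ι

  α^dimV⊛tutte≡-ι^n⊛G⊛H : α ^ω dimV V ⊛ T ≡ negω ι ^ω n ⊛ (representativeSum V ⊛ bicycleSum V)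
  α^dimV⊛tutte≡-ι^n⊛G⊛H =
    trans (α^dimV⊛tutte V) (cong (negω ι ^ω n ⊛_) (gaussSumV≡representativeSum⊛bicycleSum V))

  tutte-nonvanishing : ¬ qVanishes V → T ≡ 0ω
  tutte-nonvanishing q≢0 = α^ω-cancelˡ (dimV V) T 0ω (begin
    α ^ω dimV V ⊛ T                                     ≡⟨ α^dimV⊛tutte≡-ι^n⊛G⊛H ⟩
    negω ι ^ω n ⊛ (representativeSum V ⊛ bicycleSum V)  ≡⟨ cong (λ h → negω ι ^ω n ⊛ (representativeSum V ⊛ h))
                                                                (bicycleSum-nonvanishing V q≢0) ⟩
    negω ι ^ω n ⊛ (representativeSum V ⊛ 0ω)            ≡⟨ trans (cong (negω ι ^ω n ⊛_) (zeroʳ (representativeSum V)))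
                                                                 (zeroʳ (negω ι ^ω n)) ⟩
    0ω                                                  ≡⟨ sym (zeroʳ (α ^ω dimV V)) ⟩
    α ^ω dimV V ⊛ 0ω                                    ∎)
    where open ≡-Reasoning

  tutte-vanishing : qVanishes V → ∀ σ → IsBrownInvariant V σ →
                    T ≡ expπι/4 (+ toℕ σ + + n - + 3 * + rE V) ⊛ √2 ^ω d V
  tutte-vanishing q≡0 σ G≡√2^dimW⊛ω^σ =
    α^ω-cancelˡ (dimV V) T (expπι/4 (+ toℕ σ + + n - + 3 * + rE V) ⊛ √2 ^ω d V) (begin
      α ^ω dimV V ⊛ T
        ≡⟨ α^dimV⊛tutte≡-ι^n⊛G⊛H ⟩
      negω ι ^ω n ⊛ (representativeSum V ⊛ bicycleSum V)
        ≡⟨ cong₂ (λ g h → negω ι ^ω n ⊛ (g ⊛ h))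
                 (trans (sym (gaussSum≡representativeSum V)) G≡√2^dimW⊛ω^σ) (bicycleSum-vanishing V q≡0) ⟩
      negω ι ^ω n ⊛ (√2 ^ω dimW V ⊛ expπι/4 (+ toℕ σ) ⊛ ⌜ 2 ℕ.^ d V ⌝)
        ≡⟨ -ι^n⊛√2^dW⊛ω^s⊛2^d (toℕ σ) n (dimV V) (dimW V) (d V) (ℕ.m∸n+n≡m (d≤dimV V)) ⟩
      ω ^ω (toℕ σ ℕ.+ n ℕ.* 6) ⊛ √2 ^ω (dimV V ℕ.+ d V)
        ≡⟨ sym (α^dV⊛ω^[s+n-3r]⊛√2^d (toℕ σ) n (rE V) (dimV V) (d V) (rE+dimV≡n V)) ⟩
      α ^ω dimV V ⊛ (expπι/4 (+ toℕ σ + + n - + 3 * + rE V) ⊛ √2 ^ω d V) ∎)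
    where open ≡-Reasoning

theorem4 : (n : ℕ) (V : Subspace n) →
    (qVanishes V →
      Σ (Fin 8) λ σ → IsBrownInvariant V σ
        × tutte V (negω ι) ι
            ≡ expπι/4 (+ toℕ σ + + n - + 3 * + rE V) ⊛ (√2 ^ω d V))
    × (¬ qVanishes V → tutte V (negω ι) ι ≡ 0ω)
theorem4 n V = vanishing , tutte-nonvanishing V
  where
  vanishing : qVanishes V → Σ (Fin 8) λ σ → IsBrownInvariant V σ
                × tutte V (negω ι) ι ≡ expπι/4 (+ toℕ σ + + n - + 3 * + rE V) ⊛ (√2 ^ω d V)
  vanishing q≡0 = let (σ , G≡√2^dimW⊛ω^σ) = brown-invariant V q≡0
                  in σ , G≡√2^dimW⊛ω^σ , tutte-vanishing V q≡0 σ G≡√2^dimW⊛ω^σ
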